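{- Let \(n\) be a nonnegative integer, let \(A\) and \(B\) be subsets of \(\{0,1,\ldots,n\}\) of equal size, and let \(A^\mathsf{c}\) and \(B^\mathsf{c}\) be their complements in \(\{0,1,\ldots,n\}\). Let \(\alpha\) and \(\beta\) be partitions with \(n\) parts (with parts equal to \(0\) permitted) such that \(\alpha_i \leq \beta_i\) for all \(i \in [n]\). Suppose each part of \(\alpha\) and \(\beta\) is at most \(1\) less than the preceding part. Then the determinants \[ \det\Bigl( h_{b - a} (x_{\alpha_{a+1}+1}, x_{\alpha_{a+1}+2}, \ldots, x_{\beta_{b}}) \Bigr)_{a \in A, b \in B} \] and \[ \det\Bigl( e_{a' - b'} (x_{\alpha_{a'}+1}, x_{\alpha_{a'}+2}, \ldots, x_{\beta_{b'+1}}) \Bigr)_{a' \in A^\mathsf{c}, b' \in B^\mathsf{c}} \] are equal.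
   Context: Here \(h_i\) and \(e_i\) denote the complete homogeneous and elementary symmetric polynomials of degree \(i\), with the conventions \(e_0 = h_0 = 1\) and \(e_d = h_d = 0\) for \(d < 0\); symmetric polynomials of positive degree in an empty set of variables are \(0\). Finite subsets of \(\mathbb{Z}\) used to index matrix rows and columns are ordered from smallest to largest element. Where needed, \(\alpha_{n+1}\) is interpreted as \(\alpha_n\) and \(\beta_0\) as \(\beta_1\). -}

module Defs where

open import Algebra.Bundles using (CommutativeRing)
open import Data.Bool using (true; false)
open import Data.Nat as ℕ using (ℕ; zero; suc; _⊓_; _⊔_; _≤_; _<_)
open import Data.Integer as ℤ using (ℤ; +_; -[1+_])
open import Data.List using (List; []; _∷_; map; upTo)
open import Data.Product using (_×_; _,_; proj₁; proj₂)
open import Data.Fin.Subset using (Subset)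
open import Data.Vec using ([]; _∷_)

picks : ∀ {a} {A : Set a} → List A → List (A × List A)
picks [] = []
picks (x ∷ xs) = (x , xs) ∷ map (λ p → proj₁ p , x ∷ proj₂ p) (picks xs)

elems : ∀ {m} → Subset m → List ℕ
elems [] = []
elems (true ∷ p) = 0 ∷ map suc (elems p)
elems (false ∷ p) = map suc (elems p)

-- α_i with the convention α_{n+1} = α_n (α is only meaningful on 1..n)
αExt : ℕ → (ℕ → ℕ) → ℕ → ℕ
αExt n α i = α (i ⊓ n)

-- β_i with the convention β_0 = β_1
βExt : (ℕ → ℕ) → ℕ → ℕ
βExt β i = β (i ⊔ 1)

StepPartition : ℕ → (ℕ → ℕ) → Set
StepPartition n α = ∀ i → 1 ≤ i → i < n → (α (suc i) ≤ α i) × (α i ≤ suc (α (suc i)))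

module _ {c ℓ} (R : CommutativeRing c ℓ) where
  open CommutativeRing R

  h : ℕ → List Carrier → Carrier
  h zero _ = 1#
  h (suc d) [] = 0#
  h (suc d) (y ∷ ys) = y * h d (y ∷ ys) + h (suc d) ys

  e : ℕ → List Carrier → Carrier
  e zero _ = 1#
  e (suc d) [] = 0#
  e (suc d) (y ∷ ys) = y * e d ys + e (suc d) ys

  hℤ : ℤ → List Carrier → Carrier
  hℤ (+ k) = h k
  hℤ -[1+ _ ] _ = 0#

  eℤ : ℤ → List Carrier → Carrier
  eℤ (+ k) = e k
  eℤ -[1+ _ ] _ = 0#

  -- the list x_{p+1}, x_{p+2}, …, x_q  (empty if q ≤ p)
  vars : (ℕ → Carrier) → ℕ → ℕ → List Carrier
  vars x p q = map (λ i → x (p ℕ.+ suc i)) (upTo (q ℕ.∸ p))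

  altSum : List Carrier → Carrier
  altSum [] = 0#
  altSum (y ∷ ys) = y - altSum ys

  -- determinant of the matrix (f r c)_{r ∈ rows, c ∈ cols}, rows and cols
  -- listed in increasing order (lists of equal length), by Laplace expansion
  -- along the first row
  det : List ℕ → List ℕ → (ℕ → ℕ → Carrier) → Carrier
  det [] cs f = 1#
  det (r ∷ rs) cs f = altSum (map (λ p → f r (proj₁ p) * det rs (proj₂ p) f) (picks cs))

  hDet : ℕ → (ℕ → ℕ) → (ℕ → ℕ) → (ℕ → Carrier) → List ℕ → List ℕ → Carrier
  hDet n α β x As Bs =
    det As Bs (λ a b → hℤ (+ b ℤ.- + a) (vars x (αExt n α (suc a)) (βExt β b)))

  eDet : ℕ → (ℕ → ℕ) → (ℕ → ℕ) → (ℕ → Carrier) → List ℕ → List ℕ → Carrier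
  eDet n α β x As Bs =
    det As Bs (λ a b → eℤ (+ a ℤ.- + b) (vars x (αExt n α a) (βExt β (suc b))))

-- On {0,…,n} the matrices H_ab = h_{b-a}(x_{α_{a+1}+1},…,x_{β_b}) and E_ab = e_{a-b}(x_{α_a+1},…,x_{β_{b+1}})
-- are unitriangular, and E is the transpose of the inverse of S H S, S = diag((-1)^i).  For such a pair,
-- Jacobi's complementary minor theorem gives det H[A,B] = det E[Aᶜ,Bᶜ]; it is proved by induction on n,
-- expanding along the first row.  The inverse relation is read off generating functions: with
-- Λ_p(t) = ∏_{i ≤ p} (1 - x_i t) the entries are coefficients of Λ_p/Λ_q, and because α and β drop by at
-- most one per step, Σ_j (-1)^{j-k} H_kj E_aj (k < a) telescopes to the coefficient of t^{a-k} in
-- Λ_{α_{k+1}}/Λ_{α_a}, which vanishes: this is a polynomial of degree α_{k+1} - α_a < a - k.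

module Submission where

open import Defs
open import Level using (Level)
open import Algebra.Bundles using (CommutativeRing)
open import Data.Nat using (ℕ; suc; _≤_)
open import Data.Fin.Subset using (Subset; ∁; ∣_∣)
open import Relation.Binary.PropositionalEquality using (_≡_)

module RingSolver {c ℓ} (R : CommutativeRing c ℓ) where

  open import Data.Nat as ℕ using (zero)
  import Data.Nat.Properties as ℕ
  open import Data.Integer as ℤ using (ℤ; +_; -[1+_]; _⊖_; _◃_; sign)
  import Data.Integer.Properties as ℤ
  open import Data.Sign as Sign using (Sign)
  open import Data.Maybe using (just; nothing)
  open import Relation.Nullary using (yes; no)
  import Relation.Binary.PropositionalEquality as ≡
  open import Relation.Binary.Definitions using (WeaklyDecidable)
  open import Algebra.Solver.Ring.AlmostCommutativeRing
    using (fromCommutativeRing; _-Raw-AlmostCommutative⟶_; Induced-equivalence)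

  open CommutativeRing R
  open import Algebra.Properties.Ring ring using (-‿distribˡ-*; -‿distribʳ-*)
  open import Algebra.Properties.AbelianGroup +-abelianGroup using (⁻¹-∙-comm; ⁻¹-involutive; ε⁻¹≈ε)
  open import Algebra.Properties.Semiring.Mult.TCOptimised semiring using (_×_; 1+×; ×-homo-+; ×1-homo-*)
  open import Algebra.Solver.CommutativeMonoid +-commutativeMonoid using (_⊕_; _⊜_)
    renaming (solve to solve-+)
  open import Relation.Binary.Reasoning.Setoid setoid

  fromℤ : ℤ → Carrier
  fromℤ (+ n) = n × 1#
  fromℤ -[1+ n ] = - (suc n × 1#)

  private
    fromℤ-⊖ : ∀ m n → fromℤ (m ⊖ n) ≈ m × 1# - n × 1#
    fromℤ-⊖ m zero = sym (trans (+-cong refl ε⁻¹≈ε) (+-identityʳ _))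
    fromℤ-⊖ zero (suc n) = sym (+-identityˡ _)
    fromℤ-⊖ (suc m) (suc n) = begin
      fromℤ (suc m ⊖ suc n)              ≡⟨ ≡.cong fromℤ (ℤ.[1+m]⊖[1+n]≡m⊖n m n) ⟩
      fromℤ (m ⊖ n)                      ≈⟨ fromℤ-⊖ m n ⟩
      m × 1# - n × 1#                    ≈⟨ +-identityˡ _ ⟨
      0# + (m × 1# - n × 1#)             ≈⟨ +-cong (-‿inverseʳ 1#) refl ⟨
      (1# - 1#) + (m × 1# - n × 1#)      ≈⟨ solve-+ 4 (λ a b c d → (a ⊕ b) ⊕ (c ⊕ d) ⊜ (a ⊕ c) ⊕ (b ⊕ d)) refl
                                              1# (- 1#) (m × 1#) (- (n × 1#)) ⟩
      (1# + m × 1#) + (- 1# - n × 1#)    ≈⟨ +-cong refl (⁻¹-∙-comm 1# (n × 1#)) ⟩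
      (1# + m × 1#) - (1# + n × 1#)      ≈⟨ +-cong (1+× m 1#) (-‿cong (1+× n 1#)) ⟨
      suc m × 1# - suc n × 1#            ∎

    fromℤ-+ : ∀ i j → fromℤ (i ℤ.+ j) ≈ fromℤ i + fromℤ j
    fromℤ-+ (+ m) (+ n) = ×-homo-+ 1# m n
    fromℤ-+ (+ m) -[1+ n ] = fromℤ-⊖ m (suc n)
    fromℤ-+ -[1+ m ] (+ n) = trans (fromℤ-⊖ n (suc m)) (+-comm _ _)
    fromℤ-+ -[1+ m ] -[1+ n ] = begin
      - (suc (suc (m ℕ.+ n)) × 1#)       ≡⟨ ≡.cong (λ k → - (k × 1#)) (≡.sym (ℕ.+-suc (suc m) n)) ⟩
      - ((suc m ℕ.+ suc n) × 1#)         ≈⟨ -‿cong (×-homo-+ 1# (suc m) (suc n)) ⟩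
      - (suc m × 1# + suc n × 1#)        ≈⟨ ⁻¹-∙-comm _ _ ⟨
      - (suc m × 1#) - suc n × 1#        ∎

    signed : Sign → Carrier → Carrier
    signed Sign.+ x = x
    signed Sign.- x = - x

    signed-cong : ∀ s {x y} → x ≈ y → signed s x ≈ signed s y
    signed-cong Sign.+ x≈y = x≈y
    signed-cong Sign.- x≈y = -‿cong x≈y

    signed-* : ∀ s t x y → signed (s Sign.* t) (x * y) ≈ signed s x * signed t y
    signed-* Sign.+ Sign.+ x y = refl
    signed-* Sign.+ Sign.- x y = -‿distribʳ-* x y
    signed-* Sign.- Sign.+ x y = -‿distribˡ-* x y
    signed-* Sign.- Sign.- x y = begin
      x * y          ≈⟨ ⁻¹-involutive _ ⟨
      - - (x * y)    ≈⟨ -‿cong (-‿distribˡ-* x y) ⟩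
      - (- x * y)    ≈⟨ -‿distribʳ-* (- x) y ⟩
      - x * - y      ∎

    fromℤ-◃ : ∀ s n → fromℤ (s ◃ n) ≈ signed s (n × 1#)
    fromℤ-◃ Sign.+ zero = refl
    fromℤ-◃ Sign.- zero = sym ε⁻¹≈ε
    fromℤ-◃ Sign.+ (suc n) = refl
    fromℤ-◃ Sign.- (suc n) = refl

    fromℤ-signed : ∀ i → fromℤ i ≈ signed (sign i) (ℤ.∣ i ∣ × 1#)
    fromℤ-signed (+ n) = refl
    fromℤ-signed -[1+ n ] = refl

    fromℤ-* : ∀ i j → fromℤ (i ℤ.* j) ≈ fromℤ i * fromℤ j
    fromℤ-* i j = begin
      fromℤ (s ◃ ℤ.∣ i ∣ ℕ.* ℤ.∣ j ∣)                                 ≈⟨ fromℤ-◃ s (ℤ.∣ i ∣ ℕ.* ℤ.∣ j ∣) ⟩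
      signed s ((ℤ.∣ i ∣ ℕ.* ℤ.∣ j ∣) × 1#)                           ≈⟨ signed-cong s (×1-homo-* ℤ.∣ i ∣ ℤ.∣ j ∣) ⟩
      signed s (ℤ.∣ i ∣ × 1# * ℤ.∣ j ∣ × 1#)                          ≈⟨ signed-* (sign i) (sign j) _ _ ⟩
      signed (sign i) (ℤ.∣ i ∣ × 1#) * signed (sign j) (ℤ.∣ j ∣ × 1#) ≈⟨ *-cong (fromℤ-signed i) (fromℤ-signed j) ⟨
      fromℤ i * fromℤ j                                           ∎
      where s = sign i Sign.* sign j

    fromℤ-neg : ∀ i → fromℤ (ℤ.- i) ≈ - fromℤ i
    fromℤ-neg (+ zero) = sym ε⁻¹≈ε
    fromℤ-neg (+ suc n) = refl
    fromℤ-neg -[1+ n ] = sym (⁻¹-involutive _)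

  fromℤ-homomorphism : ℤ.+-*-rawRing -Raw-AlmostCommutative⟶ fromCommutativeRing R
  fromℤ-homomorphism = record
    { ⟦_⟧ = fromℤ ; +-homo = fromℤ-+ ; *-homo = fromℤ-* ; -‿homo = fromℤ-neg
    ; 0-homo = refl ; 1-homo = refl }

  fromℤ-≡? : WeaklyDecidable (Induced-equivalence fromℤ-homomorphism)
  fromℤ-≡? i j with i ℤ.≟ j
  ... | yes ≡.refl = just refl
  ... | no _ = nothing

  -- Integer coefficients let normalisation cancel terms such as x - x, which
  -- coefficients drawn from the abstract carrier cannot.
  open import Algebra.Solver.Ring ℤ.+-*-rawRing (fromCommutativeRing R) fromℤ-homomorphism fromℤ-≡? public
    using (solve; _:=_; _:+_; _:*_; :-_; _:-_; con)

module Sums {c ℓ} (R : CommutativeRing c ℓ) where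

  open import Data.Nat as ℕ using (zero)
  open import Data.List using (List; []; _∷_; map; _++_; length)
  open import Data.List.Relation.Unary.All using (All; []; _∷_)
  open import Data.Integer using (+_)

  open CommutativeRing R
  open RingSolver R using (solve; _:=_; _:+_; _:*_; :-_; _:-_; con)

  infixr 8 -1^_·_

  -1^_·_ : ℕ → Carrier → Carrier
  -1^ zero · x = x
  -1^ suc k · x = - (-1^ k · x)

  -1^-cong : ∀ k {x y} → x ≈ y → -1^ k · x ≈ -1^ k · y
  -1^-cong zero x≈y = x≈y
  -1^-cong (suc k) x≈y = -‿cong (-1^-cong k x≈y)

  -1^-neg : ∀ k x → -1^ k · (- x) ≈ - (-1^ k · x)
  -1^-neg zero x = refl
  -1^-neg (suc k) x = -‿cong (-1^-neg k x)

  -1^-*ˡ : ∀ k x y → -1^ k · (x * y) ≈ (-1^ k · x) * y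
  -1^-*ˡ zero x y = refl
  -1^-*ˡ (suc k) x y = trans (-‿cong (-1^-*ˡ k x y)) (solve 2 (λ a b → :- (a :* b) := (:- a) :* b) refl _ _)

  -1^-*ʳ : ∀ k x y → -1^ k · (x * y) ≈ x * (-1^ k · y)
  -1^-*ʳ zero x y = refl
  -1^-*ʳ (suc k) x y = trans (-‿cong (-1^-*ʳ k x y)) (solve 2 (λ a b → :- (a :* b) := a :* (:- b)) refl _ _)

  -1^-+ : ∀ k x y → -1^ k · (x + y) ≈ -1^ k · x + -1^ k · y
  -1^-+ zero x y = refl
  -1^-+ (suc k) x y = trans (-‿cong (-1^-+ k x y)) (solve 2 (λ a b → :- (a :+ b) := (:- a) :+ (:- b)) refl _ _)

  -1^-zero : ∀ k → -1^ k · 0# ≈ 0#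
  -1^-zero zero = refl
  -1^-zero (suc k) = trans (-‿cong (-1^-zero k)) (solve 0 (:- con (+ 0) := con (+ 0)) refl)

  -1^-involutive : ∀ k x → -1^ k · -1^ k · x ≈ x
  -1^-involutive zero x = refl
  -1^-involutive (suc k) x = begin
    - (-1^ k · - (-1^ k · x))  ≈⟨ -‿cong (-1^-neg k _) ⟩
    - - (-1^ k · -1^ k · x)    ≈⟨ -‿cong (-‿cong (-1^-involutive k x)) ⟩
    - - x                      ≈⟨ solve 1 (λ a → :- (:- a) := a) refl x ⟩
    x                          ∎
    where open import Relation.Binary.Reasoning.Setoid setoid

  ∑< : ℕ → (ℕ → Carrier) → Carrier
  ∑< zero f = 0#
  ∑< (suc m) f = f 0 + ∑< m (λ t → f (suc t))

  syntax ∑< m (λ t → e) = ∑[ t < m ] e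

  ∑-cong : ∀ m {f g : ℕ → Carrier} → (∀ t → t ℕ.< m → f t ≈ g t) → ∑< m f ≈ ∑< m g
  ∑-cong zero f≈g = refl
  ∑-cong (suc m) f≈g = +-cong (f≈g 0 (ℕ.s≤s ℕ.z≤n)) (∑-cong m (λ t t<m → f≈g (suc t) (ℕ.s≤s t<m)))

  ∑-zero : ∀ m {f : ℕ → Carrier} → (∀ t → f t ≈ 0#) → ∑< m f ≈ 0#
  ∑-zero zero f≈0 = refl
  ∑-zero (suc m) f≈0 = trans (+-cong (f≈0 0) (∑-zero m (λ t → f≈0 (suc t)))) (+-identityˡ _)

  ∑-neg : ∀ m (f : ℕ → Carrier) → ∑[ t < m ] (- f t) ≈ - ∑< m f
  ∑-neg zero f = solve 0 (con (+ 0) := :- con (+ 0)) refl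
  ∑-neg (suc m) f = trans (+-cong refl (∑-neg m (λ t → f (suc t))))
                          (solve 2 (λ a b → (:- a) :+ (:- b) := :- (a :+ b)) refl _ _)

  ∑-+ : ∀ m n (f : ℕ → Carrier) → ∑< (m ℕ.+ n) f ≈ ∑< m f + (∑[ t < n ] f (m ℕ.+ t))
  ∑-+ zero n f = sym (+-identityˡ _)
  ∑-+ (suc m) n f = trans (+-cong refl (∑-+ m n (λ t → f (suc t)))) (sym (+-assoc _ _ _))

  module _ {a} {A : Set a} where

    altSum-cong : ∀ (xs : List A) {F G : A → Carrier} → All (λ p → F p ≈ G p) xs →
                  altSum R (map F xs) ≈ altSum R (map G xs)
    altSum-cong [] [] = refl
    altSum-cong (x ∷ xs) (Fx≈Gx ∷ F≈G) = +-cong Fx≈Gx (-‿cong (altSum-cong xs F≈G))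

    altSum-zero : ∀ (xs : List A) {F : A → Carrier} → All (λ p → F p ≈ 0#) xs → altSum R (map F xs) ≈ 0#
    altSum-zero [] [] = refl
    altSum-zero (x ∷ xs) (Fx≈0 ∷ F≈0) =
      trans (+-cong Fx≈0 (-‿cong (altSum-zero xs F≈0))) (solve 0 (con (+ 0) :- con (+ 0) := con (+ 0)) refl)

    altSum-+ : ∀ (xs : List A) (F G : A → Carrier) →
               altSum R (map (λ p → F p + G p) xs) ≈ altSum R (map F xs) + altSum R (map G xs)
    altSum-+ [] F G = solve 0 (con (+ 0) := con (+ 0) :+ con (+ 0)) refl
    altSum-+ (x ∷ xs) F G = trans (+-cong refl (-‿cong (altSum-+ xs F G)))
      (solve 4 (λ a b u v → (a :+ b) :- (u :+ v) := (a :- u) :+ (b :- v)) refl _ _ _ _)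

    altSum-* : ∀ (xs : List A) k (F : A → Carrier) → altSum R (map (λ p → k * F p) xs) ≈ k * altSum R (map F xs)
    altSum-* [] k F = sym (zeroʳ k)
    altSum-* (x ∷ xs) k F = trans (+-cong refl (-‿cong (altSum-* xs k F)))
      (solve 3 (λ k a u → k :* a :- k :* u := k :* (a :- u)) refl _ _ _)

    altSum-neg : ∀ (xs : List A) {F G : A → Carrier} → All (λ p → F p ≈ - G p) xs →
                 altSum R (map F xs) ≈ - altSum R (map G xs)
    altSum-neg [] [] = solve 0 (con (+ 0) := :- con (+ 0)) refl
    altSum-neg (x ∷ xs) (Fx≈-Gx ∷ F≈-G) = trans (+-cong Fx≈-Gx (-‿cong (altSum-neg xs F≈-G)))
      (solve 2 (λ a u → (:- a) :- (:- u) := :- (a :- u)) refl _ _)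

  altSum-++ : ∀ (xs ys : List Carrier) → altSum R (xs ++ ys) ≈ altSum R xs + -1^ length xs · altSum R ys
  altSum-++ [] ys = sym (+-identityˡ _)
  altSum-++ (x ∷ xs) ys = trans (+-cong refl (-‿cong (altSum-++ xs ys)))
    (solve 3 (λ a u v → a :- (u :+ v) := (a :- u) :+ (:- v)) refl _ _ _)

module _ {a} {A : Set a} where

  open import Data.List using (List; []; _∷_; map; _++_; length)
  import Data.List.Properties as List
  open import Data.List.Relation.Unary.All as All using (All; []; _∷_)
  import Data.List.Relation.Unary.All.Properties as All
  open import Data.Product using (_×_; _,_; proj₁; proj₂)
  import Relation.Binary.PropositionalEquality as ≡

  length-picks : (xs : List A) → length (picks xs) ≡ length xs
  length-picks [] = ≡.refl
  length-picks (x ∷ xs) = ≡.cong suc (≡.trans (List.length-map _ (picks xs)) (length-picks xs))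

  picks-length : (xs : List A) → All (λ p → suc (length (proj₂ p)) ≡ length xs) (picks xs)
  picks-length [] = []
  picks-length (x ∷ xs) = ≡.refl ∷ All.map⁺ (All.map (≡.cong suc) (picks-length xs))

  picks-map : ∀ {b} {B : Set b} (g : A → B) (xs : List A) →
              picks (map g xs) ≡ map (λ p → g (proj₁ p) , map g (proj₂ p)) (picks xs)
  picks-map g [] = ≡.refl
  picks-map g (x ∷ xs) = ≡.cong ((g x , map g xs) ∷_)
    (≡.trans (≡.cong (map (λ p → proj₁ p , g x ∷ proj₂ p)) (picks-map g xs))
      (≡.trans (≡.sym (List.map-∘ (picks xs))) (List.map-∘ (picks xs))))

  picks-++ : ∀ (xs ys : List A) →
             picks (xs ++ ys) ≡ map (λ p → proj₁ p , proj₂ p ++ ys) (picks xs)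
                                ++ map (λ p → proj₁ p , xs ++ proj₂ p) (picks ys)
  picks-++ [] ys = ≡.sym (List.map-id (picks ys))
  picks-++ (x ∷ xs) ys = ≡.cong ((x , xs ++ ys) ∷_) (begin
    map cons (picks (xs ++ ys))
      ≡⟨ ≡.cong (map cons) (picks-++ xs ys) ⟩
    map cons (map (λ p → proj₁ p , proj₂ p ++ ys) (picks xs) ++ map (λ p → proj₁ p , xs ++ proj₂ p) (picks ys))
      ≡⟨ List.map-++ cons (map (λ p → proj₁ p , proj₂ p ++ ys) (picks xs)) _ ⟩
    map cons (map (λ p → proj₁ p , proj₂ p ++ ys) (picks xs)) ++ map cons (map (λ p → proj₁ p , xs ++ proj₂ p) (picks ys))
      ≡⟨ ≡.cong₂ _++_ (≡.trans (≡.sym (List.map-∘ (picks xs))) (List.map-∘ (picks xs))) (≡.sym (List.map-∘ (picks ys))) ⟩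
    map (λ p → proj₁ p , proj₂ p ++ ys) (map cons (picks xs)) ++ map (λ p → proj₁ p , x ∷ xs ++ proj₂ p) (picks ys) ∎)
    where
    open ≡.≡-Reasoning
    cons = λ (p : A × List A) → proj₁ p , x ∷ proj₂ p

module Determinant {c ℓ} (R : CommutativeRing c ℓ) where

  open import Data.Nat as ℕ using (zero; s≤s)
  import Data.Nat.Properties as ℕ
  open import Data.Integer using (+_)
  open import Data.Empty using (⊥; ⊥-elim)
  open import Data.List using (List; []; _∷_; map; _++_; length)
  import Data.List.Properties as List
  open import Data.List.Relation.Unary.All as All using (All; []; _∷_)
  import Data.List.Relation.Unary.All.Properties as All
  open import Data.Product using (_×_; _,_; proj₁; proj₂)
  import Relation.Binary.PropositionalEquality as ≡

  open CommutativeRing R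
  open import Algebra.Properties.Ring ring using (-‿distribʳ-*)
  open RingSolver R using (solve; _:=_; _:+_; _:*_; :-_; _:-_; con)
  open Sums R
  open import Relation.Binary.Reasoning.Setoid setoid

  Column : Set c
  Column = ℕ → Carrier

  column : (ℕ → ℕ → Carrier) → ℕ → Column
  column f j r = f r j

  -- det with the columns given as vectors over the rows, so that column operations act on them directly
  detᶜ : List ℕ → List Column → Carrier
  detᶜ [] vs = 1#
  detᶜ (r ∷ rs) vs = altSum R (map (λ p → proj₁ p r * detᶜ rs (proj₂ p)) (picks vs))

  det≡detᶜ : ∀ rs cs f → det R rs cs f ≡ detᶜ rs (map (column f) cs)
  det≡detᶜ [] cs f = ≡.refl
  det≡detᶜ (r ∷ rs) cs f = ≡.cong (altSum R) (≡.sym (≡.trans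
    (≡.cong (map _) (picks-map (column f) cs))
    (≡.trans (≡.sym (List.map-∘ (picks cs)))
             (List.map-cong (λ p → ≡.cong (f r (proj₁ p) *_) (≡.sym (det≡detᶜ rs (proj₂ p) f))) (picks cs)))))

  detᶜ-∷ : ∀ r rs u vs → detᶜ (r ∷ rs) (u ∷ vs) ≡
           u r * detᶜ rs vs - altSum R (map (λ p → proj₁ p r * detᶜ rs (u ∷ proj₂ p)) (picks vs))
  detᶜ-∷ r rs u vs = ≡.cong (λ z → u r * detᶜ rs vs - altSum R z) (≡.sym (List.map-∘ (picks vs)))

  detᶜ-cong-head : ∀ rs {u w : Column} vs → All (λ r → u r ≈ w r) rs → detᶜ rs (u ∷ vs) ≈ detᶜ rs (w ∷ vs)
  detᶜ-cong-head [] vs [] = refl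
  detᶜ-cong-head (r ∷ rs) {u} {w} vs (ur≈wr ∷ u≈w) = begin
    detᶜ (r ∷ rs) (u ∷ vs)
      ≡⟨ detᶜ-∷ r rs u vs ⟩
    u r * detᶜ rs vs - altSum R (map (λ p → proj₁ p r * detᶜ rs (u ∷ proj₂ p)) (picks vs))
      ≈⟨ +-cong (*-cong ur≈wr refl) (-‿cong (altSum-cong (picks vs)
           (All.universal (λ p → *-cong refl (detᶜ-cong-head rs (proj₂ p) u≈w)) (picks vs)))) ⟩
    w r * detᶜ rs vs - altSum R (map (λ p → proj₁ p r * detᶜ rs (w ∷ proj₂ p)) (picks vs))
      ≡⟨ detᶜ-∷ r rs w vs ⟨
    detᶜ (r ∷ rs) (w ∷ vs) ∎

  -- Linearity in the first column needs a row for each column (detᶜ [] vs = 1#).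
  detᶜ-linear : ∀ rs vs k (u w : Column) → length vs ℕ.< length rs →
                detᶜ rs ((λ r → k * u r + w r) ∷ vs) ≈ k * detᶜ rs (u ∷ vs) + detᶜ rs (w ∷ vs)
  detᶜ-linear (r ∷ rs) vs k u w (s≤s vs≤rs) = begin
    detᶜ (r ∷ rs) (ku+w ∷ vs)
      ≡⟨ detᶜ-∷ r rs ku+w vs ⟩
    (k * u r + w r) * detᶜ rs vs - altSum R (map (λ p → proj₁ p r * detᶜ rs (ku+w ∷ proj₂ p)) (picks vs))
      ≈⟨ +-cong refl (-‿cong (altSum-cong (picks vs) (All.map (λ {p} → minor p) (picks-length vs)))) ⟩
    (k * u r + w r) * detᶜ rs vs - altSum R (map (λ p → k * U p + W p) (picks vs))
      ≈⟨ +-cong refl (-‿cong (trans (altSum-+ (picks vs) _ W) (+-cong (altSum-* (picks vs) k U) refl))) ⟩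
    (k * u r + w r) * detᶜ rs vs - (k * altSum R (map U (picks vs)) + altSum R (map W (picks vs)))
      ≈⟨ solve 6 (λ k u w d y z → (k :* u :+ w) :* d :- (k :* y :+ z) := k :* (u :* d :- y) :+ (w :* d :- z))
           refl k (u r) (w r) (detᶜ rs vs) (altSum R (map U (picks vs))) (altSum R (map W (picks vs))) ⟩
    k * (u r * detᶜ rs vs - altSum R (map U (picks vs))) + (w r * detᶜ rs vs - altSum R (map W (picks vs)))
      ≡⟨ ≡.cong₂ (λ a b → k * a + b) (detᶜ-∷ r rs u vs) (detᶜ-∷ r rs w vs) ⟨
    k * detᶜ (r ∷ rs) (u ∷ vs) + detᶜ (r ∷ rs) (w ∷ vs) ∎
    where
    ku+w : Column
    ku+w r = k * u r + w r
    U W : Column × List Column → Carrier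
    U p = proj₁ p r * detᶜ rs (u ∷ proj₂ p)
    W p = proj₁ p r * detᶜ rs (w ∷ proj₂ p)
    minor : ∀ p → suc (length (proj₂ p)) ≡ length vs → proj₁ p r * detᶜ rs (ku+w ∷ proj₂ p) ≈ k * U p + W p
    minor p len = begin
      proj₁ p r * detᶜ rs (ku+w ∷ proj₂ p)
        ≈⟨ *-cong refl (detᶜ-linear rs (proj₂ p) k u w (≡.subst (ℕ._≤ length rs) (≡.sym len) vs≤rs)) ⟩
      proj₁ p r * (k * detᶜ rs (u ∷ proj₂ p) + detᶜ rs (w ∷ proj₂ p))
        ≈⟨ solve 4 (λ a k b c → a :* (k :* b :+ c) := k :* (a :* b) :+ a :* c) refl _ _ _ _ ⟩
      k * U p + W p ∎

  detᶜ-zeroColumn : ∀ rs vs (u : Column) → length vs ℕ.< length rs → All (λ r → u r ≈ 0#) rs →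
                    detᶜ rs (u ∷ vs) ≈ 0#
  detᶜ-zeroColumn rs vs u vs<rs u≈0 = begin
    detᶜ rs (u ∷ vs)                                     ≈⟨ detᶜ-cong-head rs vs (All.map u≈-u+u u≈0) ⟩
    detᶜ rs ((λ r → - 1# * u r + u r) ∷ vs)              ≈⟨ detᶜ-linear rs vs (- 1#) u u vs<rs ⟩
    - 1# * detᶜ rs (u ∷ vs) + detᶜ rs (u ∷ vs)           ≈⟨ solve 1 (λ d → :- con (+ 1) :* d :+ d := con (+ 0)) refl _ ⟩
    0#                                                   ∎
    where
    u≈-u+u : ∀ {r} → u r ≈ 0# → u r ≈ - 1# * u r + u r
    u≈-u+u {r} ur≈0 = trans ur≈0 (solve 1 (λ a → con (+ 0) := :- con (+ 1) :* a :+ a) refl (u r))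

  detᶜ-∑ : ∀ m rs vs (k : ℕ → Carrier) (g : ℕ → Column) → length vs ℕ.< length rs →
           detᶜ rs ((λ r → ∑[ t < m ] (k t * g t r)) ∷ vs) ≈ ∑[ t < m ] (k t * detᶜ rs (g t ∷ vs))
  detᶜ-∑ zero rs vs k g vs<rs = detᶜ-zeroColumn rs vs (λ _ → 0#) vs<rs (All.universal (λ _ → refl) rs)
  detᶜ-∑ (suc m) rs vs k g vs<rs =
    trans (detᶜ-linear rs vs (k 0) (g 0) _ vs<rs)
          (+-cong refl (detᶜ-∑ m rs vs (λ t → k (suc t)) (λ t → g (suc t)) vs<rs))

  detᶜ-expand-pair : ∀ r rs as (u w : Column) bs →
    detᶜ (r ∷ rs) (as ++ u ∷ w ∷ bs) ≈
      altSum R (map (λ p → proj₁ p r * detᶜ rs (proj₂ p ++ u ∷ w ∷ bs)) (picks as))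
      + -1^ length as · (u r * detᶜ rs (as ++ w ∷ bs) - (w r * detᶜ rs (as ++ u ∷ bs)
                         - altSum R (map (λ p → proj₁ p r * detᶜ rs (as ++ u ∷ w ∷ proj₂ p)) (picks bs))))
  detᶜ-expand-pair r rs as u w bs = begin
    altSum R (map F (picks (as ++ u ∷ w ∷ bs)))
      ≡⟨ ≡.cong (λ z → altSum R (map F z)) (picks-++ as (u ∷ w ∷ bs)) ⟩
    altSum R (map F (map before (picks as) ++ map after (picks (u ∷ w ∷ bs))))
      ≡⟨ ≡.cong (altSum R) (List.map-++ F (map before (picks as)) _) ⟩
    altSum R (map F (map before (picks as)) ++ map F (map after (picks (u ∷ w ∷ bs))))
      ≈⟨ altSum-++ (map F (map before (picks as))) _ ⟩
    altSum R (map F (map before (picks as)))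
      + -1^ length (map F (map before (picks as))) · altSum R (map F (map after (picks (u ∷ w ∷ bs))))
      ≡⟨ ≡.cong₂ _+_ (≡.cong (altSum R) (≡.sym (List.map-∘ (picks as))))
           (≡.cong₂ -1^_·_ length-as
             (≡.cong (λ z → u r * detᶜ rs (as ++ w ∷ bs) - (w r * detᶜ rs (as ++ u ∷ bs) - altSum R z)) rest)) ⟩
    _ ∎
    where
    F : Column × List Column → Carrier
    F p = proj₁ p r * detᶜ rs (proj₂ p)
    before after : Column × List Column → Column × List Column
    before p = proj₁ p , proj₂ p ++ u ∷ w ∷ bs
    after p = proj₁ p , as ++ proj₂ p
    length-as : length (map F (map before (picks as))) ≡ length as
    length-as = ≡.trans (List.length-map F (map before (picks as)))
                        (≡.trans (List.length-map before (picks as)) (length-picks as))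
    rest : map F (map after (map (λ p → proj₁ p , u ∷ proj₂ p) (map (λ p → proj₁ p , w ∷ proj₂ p) (picks bs))))
           ≡ map (λ p → proj₁ p r * detᶜ rs (as ++ u ∷ w ∷ proj₂ p)) (picks bs)
    rest = ≡.trans (≡.sym (List.map-∘ _)) (≡.trans (≡.sym (List.map-∘ _)) (≡.sym (List.map-∘ (picks bs))))

  private
    no-room : ∀ k n → k ℕ.+ suc n ℕ.≤ 0 → ⊥
    no-room k n le with ℕ.m+n≤o⇒n≤o k le
    ... | ()

    shorter-front : ∀ {k a n m} → suc k ≡ a → a ℕ.+ n ℕ.≤ suc m → k ℕ.+ n ℕ.≤ m
    shorter-front ≡.refl (s≤s le) = le

    shorter-back : ∀ {a k b m} → suc k ≡ b → a ℕ.+ suc (suc b) ℕ.≤ suc m → a ℕ.+ suc (suc k) ℕ.≤ m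
    shorter-back {a} {k} {m = m} ≡.refl le = ℕ.≤-pred (≡.subst (ℕ._≤ suc m) (ℕ.+-suc a (suc (suc k))) le)

  detᶜ-swap : ∀ rs as (u w : Column) bs → length as ℕ.+ suc (suc (length bs)) ℕ.≤ length rs →
              detᶜ rs (as ++ u ∷ w ∷ bs) ≈ - detᶜ rs (as ++ w ∷ u ∷ bs)
  detᶜ-swap [] as u w bs le = ⊥-elim (no-room (length as) _ le)
  detᶜ-swap (r ∷ rs) as u w bs le = begin
    detᶜ (r ∷ rs) (as ++ u ∷ w ∷ bs)
      ≈⟨ detᶜ-expand-pair r rs as u w bs ⟩
    X u w + -1^ length as · (U - (W - Z u w))
      ≈⟨ +-cong X-swap (-1^-cong (length as) (+-cong refl (-‿cong (+-cong refl (-‿cong Z-swap))))) ⟩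
    - X w u + -1^ length as · (U - (W - - Z w u))
      ≈⟨ +-cong refl (-1^-cong (length as) (solve 3 (λ a b z → a :- (b :- :- z) := :- (b :- (a :- z))) refl U W (Z w u))) ⟩
    - X w u + -1^ length as · - (W - (U - Z w u))
      ≈⟨ +-cong refl (-1^-neg (length as) _) ⟩
    - X w u + - (-1^ length as · (W - (U - Z w u)))
      ≈⟨ solve 2 (λ a b → :- a :+ :- b := :- (a :+ b)) refl (X w u) _ ⟩
    - (X w u + -1^ length as · (W - (U - Z w u)))
      ≈⟨ -‿cong (detᶜ-expand-pair r rs as w u bs) ⟨
    - detᶜ (r ∷ rs) (as ++ w ∷ u ∷ bs) ∎
    where
    X Z : Column → Column → Carrier
    X u w = altSum R (map (λ p → proj₁ p r * detᶜ rs (proj₂ p ++ u ∷ w ∷ bs)) (picks as))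
    Z u w = altSum R (map (λ p → proj₁ p r * detᶜ rs (as ++ u ∷ w ∷ proj₂ p)) (picks bs))
    U W : Carrier
    U = u r * detᶜ rs (as ++ w ∷ bs)
    W = w r * detᶜ rs (as ++ u ∷ bs)
    times-swap : ∀ {x y} y' → y ≈ - y' → x * y ≈ - (x * y')
    times-swap y' y≈-y' = trans (*-cong refl y≈-y') (sym (-‿distribʳ-* _ y'))
    X-swap : X u w ≈ - X w u
    X-swap = altSum-neg (picks as) (All.map (λ {p} len →
      times-swap _ (detᶜ-swap rs (proj₂ p) u w bs (shorter-front len le))) (picks-length as))
    Z-swap : Z u w ≈ - Z w u
    Z-swap = altSum-neg (picks bs) (All.map (λ {p} len →
      times-swap _ (detᶜ-swap rs as u w (proj₂ p) (shorter-back {length as} len le))) (picks-length bs))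

  detᶜ-repeat : ∀ rs as (u : Column) bs → length as ℕ.+ suc (suc (length bs)) ℕ.≤ length rs →
                detᶜ rs (as ++ u ∷ u ∷ bs) ≈ 0#
  detᶜ-repeat [] as u bs le = ⊥-elim (no-room (length as) _ le)
  detᶜ-repeat (r ∷ rs) as u bs le = begin
    detᶜ (r ∷ rs) (as ++ u ∷ u ∷ bs)
      ≈⟨ detᶜ-expand-pair r rs as u u bs ⟩
    X + -1^ length as · (U - (U - Z))
      ≈⟨ +-cong X≈0 (-1^-cong (length as) (+-cong refl (-‿cong (+-cong refl (-‿cong Z≈0))))) ⟩
    0# + -1^ length as · (U - (U - 0#))
      ≈⟨ +-cong refl (-1^-cong (length as) (solve 1 (λ a → a :- (a :- con (+ 0)) := con (+ 0)) refl U)) ⟩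
    0# + -1^ length as · 0#
      ≈⟨ trans (+-identityˡ _) (-1^-zero (length as)) ⟩
    0# ∎
    where
    X Z U : Carrier
    X = altSum R (map (λ p → proj₁ p r * detᶜ rs (proj₂ p ++ u ∷ u ∷ bs)) (picks as))
    Z = altSum R (map (λ p → proj₁ p r * detᶜ rs (as ++ u ∷ u ∷ proj₂ p)) (picks bs))
    U = u r * detᶜ rs (as ++ u ∷ bs)
    times-zero : ∀ {x y} → y ≈ 0# → x * y ≈ 0#
    times-zero y≈0 = trans (*-cong refl y≈0) (zeroʳ _)
    X≈0 : X ≈ 0#
    X≈0 = altSum-zero (picks as) (All.map (λ {p} len →
      times-zero (detᶜ-repeat rs (proj₂ p) u bs (shorter-front len le))) (picks-length as))
    Z≈0 : Z ≈ 0#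
    Z≈0 = altSum-zero (picks bs) (All.map (λ {p} len →
      times-zero (detᶜ-repeat rs as u (proj₂ p) (shorter-back {length as} len le))) (picks-length bs))

  det-∷ : ∀ r rs c cs f → det R (r ∷ rs) (c ∷ cs) f ≡
          f r c * det R rs cs f - altSum R (map (λ p → f r (proj₁ p) * det R rs (c ∷ proj₂ p) f) (picks cs))
  det-∷ r rs c cs f = ≡.cong (λ z → f r c * det R rs cs f - altSum R z) (≡.sym (List.map-∘ (picks cs)))

  det-cong : ∀ rs cs {f g : ℕ → ℕ → Carrier} → (∀ r c → f r c ≈ g r c) → det R rs cs f ≈ det R rs cs g
  det-cong [] cs f≈g = refl
  det-cong (r ∷ rs) cs f≈g =
    altSum-cong (picks cs) (All.universal (λ p → *-cong (f≈g r (proj₁ p)) (det-cong rs (proj₂ p) f≈g)) (picks cs))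

  det-shiftRows : ∀ rs cs (f : ℕ → ℕ → Carrier) → det R (map suc rs) cs f ≡ det R rs cs (λ r c → f (suc r) c)
  det-shiftRows [] cs f = ≡.refl
  det-shiftRows (r ∷ rs) cs f =
    ≡.cong (altSum R) (List.map-cong (λ p → ≡.cong (f (suc r) (proj₁ p) *_) (det-shiftRows rs (proj₂ p) f)) (picks cs))

  det-shiftColumns : ∀ rs cs (f : ℕ → ℕ → Carrier) → det R rs (map suc cs) f ≡ det R rs cs (λ r c → f r (suc c))
  det-shiftColumns [] cs f = ≡.refl
  det-shiftColumns (r ∷ rs) cs f = ≡.cong (altSum R) (≡.trans
    (≡.cong (map _) (picks-map suc cs))
    (≡.trans (≡.sym (List.map-∘ (picks cs)))
             (List.map-cong (λ p → ≡.cong (f r (suc (proj₁ p)) *_) (det-shiftColumns rs (proj₂ p) f)) (picks cs))))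

  det-shift : ∀ rs cs (f : ℕ → ℕ → Carrier) →
              det R (map suc rs) (map suc cs) f ≡ det R rs cs (λ r c → f (suc r) (suc c))
  det-shift rs cs f = ≡.trans (det-shiftRows rs (map suc cs) f) (det-shiftColumns rs cs _)

  det-zeroColumn : ∀ rs cs (f : ℕ → ℕ → Carrier) → length cs ℕ.< length rs → All (λ r → f r 0 ≈ 0#) rs →
                   det R rs (0 ∷ cs) f ≈ 0#
  det-zeroColumn rs cs f cs<rs f≈0 = trans (reflexive (det≡detᶜ rs (0 ∷ cs) f))
    (detᶜ-zeroColumn rs _ (column f 0) (≡.subst (ℕ._< length rs) (≡.sym (List.length-map (column f) cs)) cs<rs) f≈0)

  expansion-zeroRow : ∀ (g : ℕ → Carrier) (minor : List ℕ → Carrier) cs → (∀ j → g (suc j) ≈ 0#) →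
                      altSum R (map (λ p → g (proj₁ p) * minor (proj₂ p)) (picks (map suc cs))) ≈ 0#
  expansion-zeroRow g minor cs g≈0 = begin
    altSum R (map (λ p → g (proj₁ p) * minor (proj₂ p)) (picks (map suc cs)))
      ≡⟨ ≡.cong (λ z → altSum R (map _ z)) (picks-map suc cs) ⟩
    altSum R (map (λ p → g (proj₁ p) * minor (proj₂ p)) (map (λ p → suc (proj₁ p) , map suc (proj₂ p)) (picks cs)))
      ≈⟨ altSum-zero _ (All.map⁺ (All.universal (λ p → trans (*-cong (g≈0 (proj₁ p)) refl) (zeroˡ _)) (picks cs))) ⟩
    0# ∎

module _ where

  open import Data.Nat as ℕ using (z≤n; s≤s)
  import Data.Nat.Properties as ℕ
  open import Data.Bool using (true; false)
  open import Data.Vec using ([]; _∷_)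
  open import Data.List using (List; []; _∷_; map; length)
  import Data.List.Properties as List
  open import Data.List.Relation.Unary.All as All using (All; []; _∷_)
  import Data.List.Relation.Unary.All.Properties as All
  open import Data.Product using (_×_; _,_; proj₁; proj₂)
  import Relation.Binary.PropositionalEquality as ≡

  pickSub : ∀ {m} → Subset m → List (ℕ × Subset m)
  pickSub [] = []
  pickSub (true ∷ S) = (0 , false ∷ S) ∷ map (λ q → suc (proj₁ q) , true ∷ proj₂ q) (pickSub S)
  pickSub (false ∷ S) = map (λ q → suc (proj₁ q) , false ∷ proj₂ q) (pickSub S)

  picks-elems : ∀ {m} (S : Subset m) → picks (elems S) ≡ map (λ q → proj₁ q , elems (proj₂ q)) (pickSub S)
  picks-elems [] = ≡.refl
  picks-elems (true ∷ S) = ≡.cong ((0 , map suc (elems S)) ∷_) (≡.trans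
    (≡.cong (map (λ p → proj₁ p , 0 ∷ proj₂ p)) (≡.trans (picks-map suc (elems S)) (≡.cong (map _) (picks-elems S))))
    (≡.trans (≡.sym (List.map-∘ _)) (≡.trans (≡.sym (List.map-∘ (pickSub S))) (List.map-∘ (pickSub S)))))
  picks-elems (false ∷ S) = ≡.trans (picks-map suc (elems S)) (≡.trans
    (≡.cong (map _) (picks-elems S))
    (≡.trans (≡.sym (List.map-∘ (pickSub S))) (List.map-∘ (pickSub S))))

  pickSub-size : ∀ {m} (S : Subset m) → All (λ q → suc ∣ proj₂ q ∣ ≡ ∣ S ∣) (pickSub S)
  pickSub-size [] = []
  pickSub-size (true ∷ S) = ≡.refl ∷ All.map⁺ (All.map (≡.cong suc) (pickSub-size S))
  pickSub-size (false ∷ S) = All.map⁺ (pickSub-size S)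

  length-elems : ∀ {m} (S : Subset m) → length (elems S) ≡ ∣ S ∣
  length-elems [] = ≡.refl
  length-elems (true ∷ S) = ≡.cong suc (≡.trans (List.length-map suc (elems S)) (length-elems S))
  length-elems (false ∷ S) = ≡.trans (List.length-map suc (elems S)) (length-elems S)

  length-elems-∁ : ∀ {m} (S : Subset m) → length (elems (∁ S)) ℕ.+ ∣ S ∣ ≡ m
  length-elems-∁ [] = ≡.refl
  length-elems-∁ (true ∷ S) = ≡.trans (≡.cong (ℕ._+ suc ∣ S ∣) (List.length-map suc (elems (∁ S))))
                                (≡.trans (ℕ.+-suc _ ∣ S ∣) (≡.cong suc (length-elems-∁ S)))
  length-elems-∁ (false ∷ S) =
    ≡.cong suc (≡.trans (≡.cong (ℕ._+ ∣ S ∣) (List.length-map suc (elems (∁ S)))) (length-elems-∁ S))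

  elems-< : ∀ {m} (S : Subset m) → All (ℕ._< m) (elems S)
  elems-< [] = []
  elems-< (true ∷ S) = s≤s z≤n ∷ All.map⁺ (All.map s≤s (elems-< S))
  elems-< (false ∷ S) = All.map⁺ (All.map s≤s (elems-< S))

  complement-longer : ∀ {m} (A B : Subset m) → suc ∣ A ∣ ≡ ∣ B ∣ → suc (length (elems (∁ B))) ≡ length (elems (∁ A))
  complement-longer {m} A B 1+|A|≡|B| = ℕ.+-cancelʳ-≡ ∣ A ∣ _ _ (begin
    suc (length (elems (∁ B))) ℕ.+ ∣ A ∣   ≡⟨ ℕ.+-suc (length (elems (∁ B))) ∣ A ∣ ⟨
    length (elems (∁ B)) ℕ.+ suc ∣ A ∣     ≡⟨ ≡.cong (length (elems (∁ B)) ℕ.+_) 1+|A|≡|B| ⟩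
    length (elems (∁ B)) ℕ.+ ∣ B ∣         ≡⟨ length-elems-∁ B ⟩
    m                                      ≡⟨ length-elems-∁ A ⟨
    length (elems (∁ A)) ℕ.+ ∣ A ∣         ∎)
    where open ≡.≡-Reasoning

module Jacobi {c ℓ} (R : CommutativeRing c ℓ) where

  open import Level using (_⊔_)
  open import Data.Nat as ℕ using (zero; z≤n; s≤s; _∸_)
  import Data.Nat.Properties as ℕ
  open import Data.Bool using (true; false)
  open import Data.Vec using ([]; _∷_)
  open import Data.List using (List; []; _∷_; map; _++_; length; [_])
  import Data.List.Properties as List
  open import Data.List.Relation.Unary.All as All using (All; []; _∷_)
  import Data.List.Relation.Unary.All.Properties as All
  open import Data.Product using (_,_; proj₁; proj₂)
  import Relation.Binary.PropositionalEquality as ≡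

  open CommutativeRing R
  open import Algebra.Properties.Ring ring using (-‿distribʳ-*)
  open import Data.Integer using (+_)
  open RingSolver R using (solve; _:=_; _:*_; _:-_; con)
  open Sums R
  open Determinant R
  open import Relation.Binary.Reasoning.Setoid setoid

  -- Picking j from S adds column j to the columns ∁ S; moving it to the front costs (-1)^j,
  -- and the terms with j ∉ S vanish because column j then occurs twice.
  expansion-pickSub : ∀ m (S : Subset m) (col : ℕ → Column) (coeff : ℕ → Carrier) (us : List Column) rs →
    length us ℕ.+ suc (length (elems (∁ S))) ℕ.≤ length rs →
    altSum R (map (λ q → coeff (proj₁ q) * detᶜ rs (us ++ map col (elems (∁ (proj₂ q))))) (pickSub S))
    ≈ ∑[ t < m ] (-1^ t · (coeff t * detᶜ rs (us ++ col t ∷ map col (elems (∁ S)))))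
  expansion-pickSub zero [] col coeff us rs _ = refl
  expansion-pickSub (suc m) (true ∷ S) col coeff us rs room = +-cong refl (trans (-‿cong (begin
    altSum R (map (λ q → coeff (proj₁ q) * detᶜ rs (us ++ map col (elems (∁ (proj₂ q)))))
                  (map (λ q → suc (proj₁ q) , true ∷ proj₂ q) (pickSub S)))
      ≡⟨ ≡.cong (altSum R) (List.map-∘ (pickSub S)) ⟨
    altSum R (map (λ q → coeff (suc (proj₁ q)) * detᶜ rs (us ++ map col (map suc (elems (∁ (proj₂ q)))))) (pickSub S))
      ≡⟨ ≡.cong (altSum R) (List.map-cong (λ q → ≡.cong (λ z → coeff (suc (proj₁ q)) * detᶜ rs (us ++ z))
                                                         (shifted (elems (∁ (proj₂ q))))) (pickSub S)) ⟩
    altSum R (map (λ q → coeff (suc (proj₁ q)) * detᶜ rs (us ++ map (λ j → col (suc j)) (elems (∁ (proj₂ q))))) (pickSub S))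
      ≈⟨ expansion-pickSub m S (λ j → col (suc j)) (λ j → coeff (suc j)) us rs
           (≡.subst (λ k → length us ℕ.+ suc k ℕ.≤ length rs) (List.length-map suc (elems (∁ S))) room) ⟩
    ∑[ t < m ] (-1^ t · (coeff (suc t) * detᶜ rs (us ++ col (suc t) ∷ map (λ j → col (suc j)) (elems (∁ S)))))
      ≈⟨ ∑-cong m (λ t _ → -1^-cong t (*-cong refl
           (reflexive (≡.cong (λ z → detᶜ rs (us ++ col (suc t) ∷ z)) (≡.sym (shifted (elems (∁ S)))))))) ⟩
    ∑[ t < m ] (-1^ t · (coeff (suc t) * detᶜ rs (us ++ col (suc t) ∷ map col (map suc (elems (∁ S)))))) ∎))
    (sym (∑-neg m _)))
    where
    shifted : ∀ xs → map col (map suc xs) ≡ map (λ j → col (suc j)) xs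
    shifted xs = ≡.sym (List.map-∘ xs)
  expansion-pickSub (suc m) (false ∷ S) col coeff us rs room = begin
    altSum R (map (λ q → coeff (proj₁ q) * detᶜ rs (us ++ map col (elems (∁ (proj₂ q)))))
                  (map (λ q → suc (proj₁ q) , false ∷ proj₂ q) (pickSub S)))
      ≡⟨ ≡.cong (altSum R) (List.map-∘ (pickSub S)) ⟨
    altSum R (map (λ q → coeff (suc (proj₁ q)) * detᶜ rs (us ++ col 0 ∷ map col (map suc (elems (∁ (proj₂ q))))))
                  (pickSub S))
      ≡⟨ ≡.cong (altSum R) (List.map-cong (λ q → ≡.cong (λ z → coeff (suc (proj₁ q)) * detᶜ rs z)
                                                         (moved (elems (∁ (proj₂ q))))) (pickSub S)) ⟩
    altSum R (map (λ q → coeff (suc (proj₁ q)) * detᶜ rs ((us ++ [ col 0 ]) ++ map col′ (elems (∁ (proj₂ q)))))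
                  (pickSub S))
      ≈⟨ expansion-pickSub m S col′ (λ j → coeff (suc j)) (us ++ [ col 0 ]) rs room-IH ⟩
    ∑[ t < m ] (-1^ t · (coeff (suc t) * detᶜ rs ((us ++ [ col 0 ]) ++ col′ t ∷ map col′ (elems (∁ S)))))
      ≈⟨ ∑-cong m (λ t _ → swapped t) ⟩
    ∑[ t < m ] (-1^ suc t · (coeff (suc t) * detᶜ rs (us ++ col (suc t) ∷ col 0 ∷ rest)))
      ≈⟨ +-identityˡ _ ⟨
    0# + ∑[ t < m ] (-1^ suc t · (coeff (suc t) * detᶜ rs (us ++ col (suc t) ∷ col 0 ∷ rest)))
      ≈⟨ +-cong (trans (*-cong refl (detᶜ-repeat rs us (col 0) rest room′)) (zeroʳ _)) refl ⟨
    coeff 0 * detᶜ rs (us ++ col 0 ∷ col 0 ∷ rest)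
      + ∑[ t < m ] (-1^ suc t · (coeff (suc t) * detᶜ rs (us ++ col (suc t) ∷ col 0 ∷ rest))) ∎
    where
    col′ : ℕ → Column
    col′ j = col (suc j)
    rest : List Column
    rest = map col (map suc (elems (∁ S)))
    moved : ∀ xs → us ++ col 0 ∷ map col (map suc xs) ≡ (us ++ [ col 0 ]) ++ map col′ xs
    moved xs = ≡.trans (≡.cong (λ z → us ++ col 0 ∷ z) (≡.sym (List.map-∘ xs))) (≡.sym (List.++-assoc us [ col 0 ] _))
    room′ : length us ℕ.+ suc (suc (length rest)) ℕ.≤ length rs
    room′ = ≡.subst (λ k → length us ℕ.+ suc (suc k) ℕ.≤ length rs)
                    (≡.sym (List.length-map col (map suc (elems (∁ S))))) room
    room-IH : length (us ++ [ col 0 ]) ℕ.+ suc (length (elems (∁ S))) ℕ.≤ length rs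
    room-IH = ≡.subst (ℕ._≤ length rs)
      (≡.sym (≡.trans (≡.cong (ℕ._+ suc (length (elems (∁ S)))) (List.length-++ us))
                      (≡.trans (ℕ.+-assoc (length us) 1 _) (≡.cong (λ k → length us ℕ.+ suc (suc k))
                                                                   (≡.sym (List.length-map suc (elems (∁ S))))))))
      room
    swapped : ∀ t → -1^ t · (coeff (suc t) * detᶜ rs ((us ++ [ col 0 ]) ++ col′ t ∷ map col′ (elems (∁ S))))
                    ≈ -1^ suc t · (coeff (suc t) * detᶜ rs (us ++ col (suc t) ∷ col 0 ∷ rest))
    swapped t = begin
      -1^ t · (coeff (suc t) * detᶜ rs ((us ++ [ col 0 ]) ++ col′ t ∷ map col′ (elems (∁ S))))
        ≡⟨ ≡.cong (λ z → -1^ t · (coeff (suc t) * detᶜ rs z)) (moved (t ∷ elems (∁ S))) ⟨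
      -1^ t · (coeff (suc t) * detᶜ rs (us ++ col 0 ∷ col (suc t) ∷ rest))
        ≈⟨ -1^-cong t (*-cong refl (detᶜ-swap rs us (col 0) (col (suc t)) rest room′)) ⟩
      -1^ t · (coeff (suc t) * - detᶜ rs (us ++ col (suc t) ∷ col 0 ∷ rest))
        ≈⟨ -1^-cong t (-‿distribʳ-* _ _) ⟨
      -1^ t · - (coeff (suc t) * detᶜ rs (us ++ col (suc t) ∷ col 0 ∷ rest))
        ≈⟨ -1^-neg t _ ⟩
      -1^ suc t · (coeff (suc t) * detᶜ rs (us ++ col (suc t) ∷ col 0 ∷ rest)) ∎

  -- E is the transpose of (S H S)⁻¹, S = diag((-1)^i): E-recurrence is (S H S) Eᵀ = I below the diagonal.
  record InversePair (m : ℕ) (H E : ℕ → ℕ → Carrier) : Set (c ⊔ ℓ) where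
    field
      H-upperTriangular : ∀ a b → b ℕ.< a → H a b ≈ 0#
      H-diagonal        : ∀ a → H a a ≈ 1#
      E-lowerTriangular : ∀ a b → a ℕ.< b → E a b ≈ 0#
      E-diagonal        : ∀ a → E a a ≈ 1#
      E-recurrence      : ∀ k a → k ℕ.< a → a ℕ.< m →
                          E a k ≈ ∑[ t < m ∸ suc k ] (-1^ t · (H k (suc k ℕ.+ t) * E a (suc k ℕ.+ t)))

  shift : (ℕ → ℕ → Carrier) → ℕ → ℕ → Carrier
  shift f a b = f (suc a) (suc b)

  InversePair-shift : ∀ {m H E} → InversePair (suc m) H E → InversePair m (shift H) (shift E)
  InversePair-shift pair = record
    { H-upperTriangular = λ a b b<a → H-upperTriangular (suc a) (suc b) (s≤s b<a)
    ; H-diagonal        = λ a → H-diagonal (suc a)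
    ; E-lowerTriangular = λ a b a<b → E-lowerTriangular (suc a) (suc b) (s≤s a<b)
    ; E-diagonal        = λ a → E-diagonal (suc a)
    ; E-recurrence      = λ k a k<a a<m → E-recurrence (suc k) (suc a) (s≤s k<a) (s≤s a<m)
    }
    where open InversePair pair

  ComplementaryMinors : ℕ → Set (c ⊔ ℓ)
  ComplementaryMinors m = ∀ (A B : Subset m) → ∣ A ∣ ≡ ∣ B ∣ → ∀ {H E} → InversePair m H E →
                          det R (elems A) (elems B) H ≈ det R (elems (∁ A)) (elems (∁ B)) E

  private
    length-map-suc-elems : ∀ {m} (S : Subset m) → length (map suc (elems S)) ≡ ∣ S ∣
    length-map-suc-elems S = ≡.trans (List.length-map suc (elems S)) (length-elems S)

    one-times-minus-zero : ∀ {u x} → u ≈ 1# → u * x - 0# ≈ x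
    one-times-minus-zero {u} {x} u≈1 =
      trans (+-cong (*-cong u≈1 refl) refl) (solve 1 (λ x → con (+ 1) :* x :- con (+ 0) := x) refl x)

  complementary-∈∈ : ∀ {m} → ComplementaryMinors m → ∀ (A B : Subset m) → ∣ A ∣ ≡ ∣ B ∣ →
                     ∀ {H E} → InversePair (suc m) H E →
                     det R (elems (true ∷ A)) (elems (true ∷ B)) H ≈ det R (elems (∁ (true ∷ A))) (elems (∁ (true ∷ B))) E
  complementary-∈∈ IH A B |A|≡|B| {H} {E} pair = begin
    det R (0 ∷ map suc (elems A)) (0 ∷ map suc (elems B)) H
      ≡⟨ det-∷ 0 (map suc (elems A)) 0 (map suc (elems B)) H ⟩
    H 0 0 * det R (map suc (elems A)) (map suc (elems B)) H
      - altSum R (map (λ p → H 0 (proj₁ p) * det R (map suc (elems A)) (0 ∷ proj₂ p) H) (picks (map suc (elems B))))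
      ≈⟨ +-cong refl (-‿cong (altSum-zero _ (All.map (λ {p} len → trans (*-cong refl (zero-minor p len)) (zeroʳ _))
                                                       (picks-length (map suc (elems B)))))) ⟩
    H 0 0 * det R (map suc (elems A)) (map suc (elems B)) H - 0#
      ≈⟨ one-times-minus-zero (H-diagonal 0) ⟩
    det R (map suc (elems A)) (map suc (elems B)) H
      ≡⟨ det-shift (elems A) (elems B) H ⟩
    det R (elems A) (elems B) (shift H)
      ≈⟨ IH A B |A|≡|B| (InversePair-shift pair) ⟩
    det R (elems (∁ A)) (elems (∁ B)) (shift E)
      ≡⟨ det-shift (elems (∁ A)) (elems (∁ B)) E ⟨
    det R (map suc (elems (∁ A))) (map suc (elems (∁ B))) E ∎
    where
    open InversePair pair
    zero-minor : ∀ p → suc (length (proj₂ p)) ≡ length (map suc (elems B)) →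
                 det R (map suc (elems A)) (0 ∷ proj₂ p) H ≈ 0#
    zero-minor p len = det-zeroColumn _ (proj₂ p) H
      (ℕ.≤-reflexive (≡.trans len (≡.trans (length-map-suc-elems B)
                                           (≡.trans (≡.sym |A|≡|B|) (≡.sym (length-map-suc-elems A))))))
      (All.map⁺ (All.universal (λ r → H-upperTriangular (suc r) 0 (s≤s z≤n)) (elems A)))

  complementary-∉∉ : ∀ {m} → ComplementaryMinors m → ∀ (A B : Subset m) → ∣ A ∣ ≡ ∣ B ∣ →
                     ∀ {H E} → InversePair (suc m) H E →
                     det R (elems (false ∷ A)) (elems (false ∷ B)) H ≈ det R (elems (∁ (false ∷ A))) (elems (∁ (false ∷ B))) E
  complementary-∉∉ IH A B |A|≡|B| {H} {E} pair = begin
    det R (map suc (elems A)) (map suc (elems B)) H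
      ≡⟨ det-shift (elems A) (elems B) H ⟩
    det R (elems A) (elems B) (shift H)
      ≈⟨ IH A B |A|≡|B| (InversePair-shift pair) ⟩
    det R (elems (∁ A)) (elems (∁ B)) (shift E)
      ≡⟨ det-shift (elems (∁ A)) (elems (∁ B)) E ⟨
    det R (map suc (elems (∁ A))) (map suc (elems (∁ B))) E
      ≈⟨ one-times-minus-zero (E-diagonal 0) ⟨
    E 0 0 * det R (map suc (elems (∁ A))) (map suc (elems (∁ B))) E - 0#
      ≈⟨ +-cong refl (-‿cong (expansion-zeroRow (E 0) (λ cs → det R (map suc (elems (∁ A))) (0 ∷ cs) E) (elems (∁ B))
                                (λ j → E-lowerTriangular 0 (suc j) (s≤s z≤n)))) ⟨
    E 0 0 * det R (map suc (elems (∁ A))) (map suc (elems (∁ B))) E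
      - altSum R (map (λ p → E 0 (proj₁ p) * det R (map suc (elems (∁ A))) (0 ∷ proj₂ p) E) (picks (map suc (elems (∁ B)))))
      ≡⟨ det-∷ 0 (map suc (elems (∁ A))) 0 (map suc (elems (∁ B))) E ⟨
    det R (0 ∷ map suc (elems (∁ A))) (0 ∷ map suc (elems (∁ B))) E ∎
    where open InversePair pair

  complementary-∉∈ : ∀ {m} (A B : Subset m) → ∣ A ∣ ≡ suc ∣ B ∣ → ∀ {H E} → InversePair (suc m) H E →
                     det R (elems (false ∷ A)) (elems (true ∷ B)) H ≈ det R (elems (∁ (false ∷ A))) (elems (∁ (true ∷ B))) E
  complementary-∉∈ A B |A|≡1+|B| {H} {E} pair = begin
    det R (map suc (elems A)) (0 ∷ map suc (elems B)) H
      ≈⟨ det-zeroColumn _ _ H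
           (ℕ.≤-reflexive (≡.trans (≡.cong suc (length-map-suc-elems B))
                                   (≡.trans (≡.sym |A|≡1+|B|) (≡.sym (length-map-suc-elems A)))))
           (All.map⁺ (All.universal (λ r → H-upperTriangular (suc r) 0 (s≤s z≤n)) (elems A))) ⟩
    0#
      ≈⟨ expansion-zeroRow (E 0) (λ cs → det R (map suc (elems (∁ A))) cs E) (elems (∁ B))
           (λ j → E-lowerTriangular 0 (suc j) (s≤s z≤n)) ⟨
    det R (0 ∷ map suc (elems (∁ A))) (map suc (elems (∁ B))) E ∎
    where open InversePair pair

  -- Expand along row 0; by induction each minor is a minor of E whose columns are ∁ B plus one column j,
  -- and the E-recurrence recombines these into column 0 of E.
  complementary-∈∉ : ∀ {m} → ComplementaryMinors m → ∀ (A B : Subset m) → suc ∣ A ∣ ≡ ∣ B ∣ →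
                     ∀ {H E} → InversePair (suc m) H E →
                     det R (elems (true ∷ A)) (elems (false ∷ B)) H ≈ det R (elems (∁ (true ∷ A))) (elems (∁ (false ∷ B))) E
  complementary-∈∉ {m} IH A B 1+|A|≡|B| {H} {E} pair = begin
    altSum R (map (λ p → H 0 (proj₁ p) * det R (map suc (elems A)) (proj₂ p) H) (picks (map suc (elems B))))
      ≡⟨ ≡.cong (altSum R) expansion-over-B ⟩
    altSum R (map (λ q → H 0 (suc (proj₁ q)) * det R (map suc (elems A)) (map suc (elems (proj₂ q))) H) (pickSub B))
      ≈⟨ altSum-cong (pickSub B) (All.map (λ {q} size → *-cong refl (complementary-minor q size)) (pickSub-size B)) ⟩
    altSum R (map (λ q → H 0 (suc (proj₁ q)) * detᶜ (elems (∁ A)) ([] ++ map (column (shift E)) (elems (∁ (proj₂ q)))))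
                  (pickSub B))
      ≈⟨ expansion-pickSub m B (column (shift E)) (λ j → H 0 (suc j)) [] (elems (∁ A)) (ℕ.≤-reflexive ∁B<∁A) ⟩
    ∑[ t < m ] (-1^ t · (H 0 (suc t) * detᶜ (elems (∁ A)) (column (shift E) t ∷ Bᶜ)))
      ≈⟨ ∑-cong m (λ t _ → -1^-*ˡ t _ _) ⟩
    ∑[ t < m ] ((-1^ t · H 0 (suc t)) * detᶜ (elems (∁ A)) (column (shift E) t ∷ Bᶜ))
      ≈⟨ detᶜ-∑ m (elems (∁ A)) Bᶜ (λ t → -1^ t · H 0 (suc t)) (column (shift E))
           (ℕ.≤-reflexive (≡.trans (≡.cong suc (List.length-map _ (elems (∁ B)))) ∁B<∁A)) ⟨
    detᶜ (elems (∁ A)) ((λ r → ∑[ t < m ] ((-1^ t · H 0 (suc t)) * E (suc r) (suc t))) ∷ Bᶜ)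
      ≈⟨ detᶜ-cong-head (elems (∁ A)) Bᶜ (All.map recurrence (elems-< (∁ A))) ⟨
    detᶜ (elems (∁ A)) (column E₁ 0 ∷ Bᶜ)
      ≡⟨ ≡.cong (λ cs → detᶜ (elems (∁ A)) (column E₁ 0 ∷ cs)) (List.map-∘ (elems (∁ B))) ⟩
    detᶜ (elems (∁ A)) (map (column E₁) (0 ∷ map suc (elems (∁ B))))
      ≡⟨ det≡detᶜ (elems (∁ A)) (0 ∷ map suc (elems (∁ B))) E₁ ⟨
    det R (elems (∁ A)) (0 ∷ map suc (elems (∁ B))) E₁
      ≡⟨ det-shiftRows (elems (∁ A)) (0 ∷ map suc (elems (∁ B))) E ⟨
    det R (map suc (elems (∁ A))) (0 ∷ map suc (elems (∁ B))) E ∎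
    where
    open InversePair pair
    E₁ : ℕ → ℕ → Carrier
    E₁ a b = E (suc a) b
    Bᶜ : List Column
    Bᶜ = map (column (shift E)) (elems (∁ B))
    ∁B<∁A : suc (length (elems (∁ B))) ≡ length (elems (∁ A))
    ∁B<∁A = complement-longer A B 1+|A|≡|B|
    expansion-over-B : map (λ p → H 0 (proj₁ p) * det R (map suc (elems A)) (proj₂ p) H) (picks (map suc (elems B)))
                       ≡ map (λ q → H 0 (suc (proj₁ q)) * det R (map suc (elems A)) (map suc (elems (proj₂ q))) H) (pickSub B)
    expansion-over-B = ≡.trans (≡.cong (map _) (≡.trans (picks-map suc (elems B)) (≡.cong (map _) (picks-elems B))))
                               (≡.trans (≡.sym (List.map-∘ _)) (≡.sym (List.map-∘ (pickSub B))))
    complementary-minor : ∀ q → suc ∣ proj₂ q ∣ ≡ ∣ B ∣ →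
      det R (map suc (elems A)) (map suc (elems (proj₂ q))) H ≈ detᶜ (elems (∁ A)) (map (column (shift E)) (elems (∁ (proj₂ q))))
    complementary-minor q size = begin
      det R (map suc (elems A)) (map suc (elems (proj₂ q))) H
        ≡⟨ det-shift (elems A) (elems (proj₂ q)) H ⟩
      det R (elems A) (elems (proj₂ q)) (shift H)
        ≈⟨ IH A (proj₂ q) (ℕ.suc-injective (≡.trans 1+|A|≡|B| (≡.sym size))) (InversePair-shift pair) ⟩
      det R (elems (∁ A)) (elems (∁ (proj₂ q))) (shift E)
        ≡⟨ det≡detᶜ (elems (∁ A)) (elems (∁ (proj₂ q))) (shift E) ⟩
      detᶜ (elems (∁ A)) (map (column (shift E)) (elems (∁ (proj₂ q)))) ∎
    recurrence : ∀ {r} → r ℕ.< m → E (suc r) 0 ≈ ∑[ t < m ] ((-1^ t · H 0 (suc t)) * E (suc r) (suc t))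
    recurrence {r} r<m = trans (E-recurrence 0 (suc r) (s≤s z≤n) (s≤s r<m)) (∑-cong m (λ t _ → -1^-*ˡ t _ _))

  complementaryMinors : ∀ m → ComplementaryMinors m
  complementaryMinors zero [] [] _ _ = refl
  complementaryMinors (suc m) (true ∷ A) (true ∷ B) |A|≡|B| =
    complementary-∈∈ (complementaryMinors m) A B (ℕ.suc-injective |A|≡|B|)
  complementaryMinors (suc m) (false ∷ A) (false ∷ B) |A|≡|B| = complementary-∉∉ (complementaryMinors m) A B |A|≡|B|
  complementaryMinors (suc m) (false ∷ A) (true ∷ B) |A|≡|B| = complementary-∉∈ A B |A|≡|B|
  complementaryMinors (suc m) (true ∷ A) (false ∷ B) |A|≡|B| = complementary-∈∉ (complementaryMinors m) A B |A|≡|B|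

module PowerSeries {c ℓ} (R : CommutativeRing c ℓ) where

  open import Data.Nat as ℕ using (zero; z≤n; s≤s; _∸_)
  import Data.Nat.Properties as ℕ
  open import Data.Integer using (+_)
  open import Data.List using (List; []; _∷_; map; _++_; length; [_]; upTo)
  import Data.List.Properties as List
  open import Data.Sum using (_⊎_; inj₁; inj₂)
  open import Relation.Nullary using (yes; no)
  import Relation.Binary.PropositionalEquality as ≡

  open CommutativeRing R hiding (zero)
  open RingSolver R using (solve; _:=_; _:+_; _:*_; :-_; _:-_; con)
  open Sums R
  open import Relation.Binary.Reasoning.Setoid setoid

  infixl 7 _⋆_

  _⋆_ : (ℕ → Carrier) → (ℕ → Carrier) → ℕ → Carrier
  (F ⋆ G) d = ∑[ s < suc d ] (F s * G (d ∸ s))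

  -- If F = F′/(1 - y t) and G = (1 - y t) G′ then F G = F′ G′; stated for the coefficient of t^(d+1)
  -- without assuming F 0 = F′ 0.
  ⋆-cancel : ∀ d (F F′ G G′ : ℕ → Carrier) y → (∀ s → F (suc s) ≈ F′ (suc s) + y * F s) →
             (∀ i → G (suc i) ≈ G′ (suc i) - y * G′ i) → G 0 ≈ G′ 0 →
             F 0 * G′ (suc d) + ((λ s → F′ (suc s)) ⋆ G′) d ≈ (F ⋆ G) (suc d)
  ⋆-cancel zero F F′ G G′ y F-rec G-rec G₀ = sym (begin
    F 0 * G 1 + (F 1 * G 0 + 0#)
      ≈⟨ +-cong (*-cong refl (G-rec 0)) (+-cong (*-cong (F-rec 0) G₀) refl) ⟩
    F 0 * (G′ 1 - y * G′ 0) + ((F′ 1 + y * F 0) * G′ 0 + 0#)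
      ≈⟨ solve 5 (λ f₀ g₁ y g₀ f₁ → f₀ :* (g₁ :- y :* g₀) :+ ((f₁ :+ y :* f₀) :* g₀ :+ con (+ 0))
                                   := f₀ :* g₁ :+ (f₁ :* g₀ :+ con (+ 0))) refl (F 0) (G′ 1) y (G′ 0) (F′ 1) ⟩
    F 0 * G′ 1 + (F′ 1 * G′ 0 + 0#) ∎)
  ⋆-cancel (suc d) F F′ G G′ y F-rec G-rec G₀ = sym (begin
    F 0 * G (suc (suc d)) + ((λ s → F (suc s)) ⋆ G) (suc d)
      ≈⟨ +-cong refl (⋆-cancel d (λ s → F (suc s)) (λ s → F′ (suc s)) G G′ y (λ s → F-rec (suc s)) G-rec G₀) ⟨
    F 0 * G (suc (suc d)) + (F 1 * G′ (suc d) + T)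
      ≈⟨ +-cong (*-cong refl (G-rec (suc d))) (+-cong (*-cong (F-rec 0) refl) refl) ⟩
    F 0 * (G′ (suc (suc d)) - y * G′ (suc d)) + ((F′ 1 + y * F 0) * G′ (suc d) + T)
      ≈⟨ solve 6 (λ f₀ a y b f₁ t → f₀ :* (a :- y :* b) :+ ((f₁ :+ y :* f₀) :* b :+ t) := f₀ :* a :+ (f₁ :* b :+ t))
           refl (F 0) (G′ (suc (suc d))) y (G′ (suc d)) (F′ 1) T ⟩
    F 0 * G′ (suc (suc d)) + (F′ 1 * G′ (suc d) + T) ∎)
    where
    T : Carrier
    T = ((λ s → F′ (suc (suc s))) ⋆ G′) d

  StepsDown : ℕ → (ℕ → ℕ) → Set
  StepsDown d Q = ∀ r → r ℕ.< d → Q r ≡ Q (suc r) ⊎ Q r ≡ suc (Q (suc r))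

  -- For series families with F (c+1) = F c / (1 - y_{c+1} t) and G (c+1) = (1 - y_{c+1} t) G c,
  -- the products F c G c do not depend on c; along an index sequence Q dropping by at most one per
  -- step this lets the sum on the left be collapsed one term at a time.
  ⋆-telescope : ∀ (y : ℕ → Carrier) d (F G : ℕ → ℕ → Carrier) (Q : ℕ → ℕ) →
    (∀ c s → F (suc c) (suc s) ≈ F c (suc s) + y (suc c) * F (suc c) s) →
    (∀ c i → G (suc c) (suc i) ≈ G c (suc i) - y (suc c) * G c i) → (∀ c → G c 0 ≈ 1#) →
    StepsDown d Q → ∑[ t < suc d ] (F (Q t) t * G (Q (suc t)) (d ∸ t)) ≈ (F (Q 0) ⋆ G (Q 0)) d
  ⋆-telescope y zero F G Q F-rec G-rec G₀ _ = +-cong (*-cong refl (trans (G₀ (Q 1)) (sym (G₀ (Q 0))))) refl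
  ⋆-telescope y (suc d) F G Q F-rec G-rec G₀ steps = trans
    (+-cong refl (⋆-telescope y d (λ c s → F c (suc s)) G (λ r → Q (suc r)) (λ c s → F-rec c (suc s)) G-rec G₀
                                  (λ r r<d → steps (suc r) (s≤s r<d))))
    (collapse (Q 0) (Q 1) (steps 0 (s≤s z≤n)))
    where
    collapse : ∀ a b → a ≡ b ⊎ a ≡ suc b →
               F a 0 * G b (suc d) + ((λ s → F b (suc s)) ⋆ G b) d ≈ (F a ⋆ G a) (suc d)
    collapse a .a (inj₁ ≡.refl) = refl
    collapse .(suc b) b (inj₂ ≡.refl) =
      ⋆-cancel d (F (suc b)) (F b) (G (suc b)) (G b) (y (suc b)) (F-rec b) (G-rec b) (trans (G₀ (suc b)) (sym (G₀ b)))

  h-∷ʳ : ∀ ys y s → h R (suc s) (ys ++ [ y ]) ≈ h R (suc s) ys + y * h R s (ys ++ [ y ])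
  h-∷ʳ [] y s = +-comm _ _
  h-∷ʳ (z ∷ zs) y zero = trans (+-cong refl (h-∷ʳ zs y zero))
    (solve 3 (λ z a y → z :* con (+ 1) :+ (a :+ y :* con (+ 1)) := (z :* con (+ 1) :+ a) :+ y :* con (+ 1)) refl
       z (h R 1 zs) y)
  h-∷ʳ (z ∷ zs) y (suc s) = trans (+-cong (*-cong refl (h-∷ʳ (z ∷ zs) y s)) (h-∷ʳ zs y (suc s)))
    (solve 6 (λ z a y b c d → z :* (a :+ y :* b) :+ (c :+ y :* d) := (z :* a :+ c) :+ y :* (z :* b :+ d)) refl
       z (h R (suc s) (z ∷ zs)) y (h R s (z ∷ zs ++ [ y ])) (h R (suc (suc s)) zs) (h R (suc s) (zs ++ [ y ])))

  e-∷ʳ : ∀ ys y s → e R (suc s) (ys ++ [ y ]) ≈ e R (suc s) ys + y * e R s ys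
  e-∷ʳ [] y s = +-comm _ _
  e-∷ʳ (z ∷ zs) y zero = trans (+-cong refl (e-∷ʳ zs y zero))
    (solve 3 (λ z a y → z :* con (+ 1) :+ (a :+ y :* con (+ 1)) := (z :* con (+ 1) :+ a) :+ y :* con (+ 1)) refl
       z (e R 1 zs) y)
  e-∷ʳ (z ∷ zs) y (suc s) = trans (+-cong (*-cong refl (e-∷ʳ zs y s)) (e-∷ʳ zs y (suc s)))
    (solve 5 (λ z a y b c → z :* (a :+ y :* b) :+ (c :+ y :* a) := (z :* a :+ c) :+ y :* (z :* b :+ a)) refl
       z (e R (suc s) zs) y (e R s zs) (e R (suc (suc s)) zs))

  e-vanishes : ∀ d ys → length ys ℕ.< d → e R d ys ≈ 0#
  e-vanishes (suc d) [] _ = refl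
  e-vanishes (suc d) (z ∷ zs) (s≤s |zs|<d) =
    trans (+-cong (*-cong refl (e-vanishes d zs |zs|<d)) (e-vanishes (suc d) zs (ℕ.m<n⇒m<1+n |zs|<d)))
          (trans (+-cong (zeroʳ z) refl) (+-identityˡ _))

  module Ratio (x : ℕ → Carrier) where

    length-vars : ∀ p q → length (vars R x p q) ≡ q ∸ p
    length-vars p q = ≡.trans (List.length-map _ (upTo (q ∸ p))) (List.length-upTo (q ∸ p))

    vars-empty : ∀ {p q} → q ℕ.≤ p → vars R x p q ≡ []
    vars-empty {p} le = ≡.cong (λ k → map (λ i → x (p ℕ.+ suc i)) (upTo k)) (ℕ.m≤n⇒m∸n≡0 le)

    vars-∷ : ∀ {c p} → c ℕ.< p → vars R x c p ≡ x (suc c) ∷ vars R x (suc c) p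
    vars-∷ {c} {suc p} (s≤s c≤p) = ≡.trans
      (≡.cong (λ k → map f (upTo k)) (ℕ.+-∸-assoc 1 c≤p))
      (≡.cong₂ _∷_ (≡.cong x (ℕ.+-comm c 1))
        (≡.trans (List.map-applyUpTo suc f (p ∸ c))
          (≡.trans (≡.sym (List.map-applyUpTo (λ i → i) (λ i → f (suc i)) (p ∸ c)))
            (List.map-cong (λ i → ≡.cong x (ℕ.+-suc c (suc i))) (upTo (p ∸ c))))))
      where
      f : ℕ → Carrier
      f i = x (c ℕ.+ suc i)

    vars-∷ʳ : ∀ {p c} → p ℕ.≤ c → vars R x p (suc c) ≡ vars R x p c ++ [ x (suc c) ]
    vars-∷ʳ {p} {c} p≤c = ≡.trans
      (≡.cong (λ k → map f (upTo k)) (ℕ.+-∸-assoc 1 p≤c))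
      (≡.trans (≡.cong (map f) (≡.sym (List.upTo-∷ʳ (c ∸ p))))
        (≡.trans (List.map-++ f (upTo (c ∸ p)) [ c ∸ p ])
          (≡.cong (λ z → map f (upTo (c ∸ p)) ++ [ z ])
            (≡.cong x (≡.trans (ℕ.+-suc p (c ∸ p)) (≡.cong suc (ℕ.m+[n∸m]≡n p≤c)))))))
      where
      f : ℕ → Carrier
      f i = x (p ℕ.+ suc i)

    δ₀ : ℕ → Carrier
    δ₀ zero = 1#
    δ₀ (suc _) = 0#

    -- ratio p q r is the coefficient of t^r in Λ_p(t)/Λ_q(t), where Λ_p(t) = ∏_{i ≤ p} (1 - x_i t).
    -- Of the two summands only one has a nonempty variable list; the other is δ₀ r, hence the correction.
    ratio : ℕ → ℕ → ℕ → Carrier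
    ratio p q r = h R r (vars R x p q) + -1^ r · e R r (vars R x q p) - δ₀ r

    ratio-h : ∀ {p q} r → p ℕ.≤ q → ratio p q r ≈ h R r (vars R x p q)
    ratio-h {p} {q} r p≤q = begin
      h R r (vars R x p q) + -1^ r · e R r (vars R x q p) - δ₀ r
        ≡⟨ ≡.cong (λ z → h R r (vars R x p q) + -1^ r · e R r z - δ₀ r) (vars-empty p≤q) ⟩
      h R r (vars R x p q) + -1^ r · e R r [] - δ₀ r
        ≈⟨ trans (+-assoc _ _ _) (+-cong refl (empty r)) ⟩
      h R r (vars R x p q) + 0#
        ≈⟨ +-identityʳ _ ⟩
      h R r (vars R x p q) ∎
      where
      empty : ∀ r → -1^ r · e R r [] - δ₀ r ≈ 0#
      empty zero = -‿inverseʳ 1#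
      empty (suc r) = trans (+-cong (-1^-zero (suc r)) refl) (-‿inverseʳ 0#)

    ratio-e : ∀ {p q} r → q ℕ.≤ p → ratio p q r ≈ -1^ r · e R r (vars R x q p)
    ratio-e {p} {q} r q≤p = begin
      h R r (vars R x p q) + -1^ r · e R r (vars R x q p) - δ₀ r
        ≡⟨ ≡.cong (λ z → h R r z + -1^ r · e R r (vars R x q p) - δ₀ r) (vars-empty q≤p) ⟩
      h R r [] + -1^ r · e R r (vars R x q p) - δ₀ r
        ≈⟨ solve 3 (λ a b d → a :+ b :- d := b :+ (a :- d)) refl _ _ _ ⟩
      -1^ r · e R r (vars R x q p) + (h R r [] - δ₀ r)
        ≈⟨ +-cong refl (empty r) ⟩
      -1^ r · e R r (vars R x q p) + 0#
        ≈⟨ +-identityʳ _ ⟩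
      -1^ r · e R r (vars R x q p) ∎
      where
      empty : ∀ r → h R r [] - δ₀ r ≈ 0#
      empty zero = -‿inverseʳ 1#
      empty (suc r) = -‿inverseʳ 0#

    ratio-0 : ∀ p q → ratio p q 0 ≈ 1#
    ratio-0 p q = solve 1 (λ a → a :+ a :- a := a) refl 1#

    ratio-sucʳ : ∀ p c s → ratio p (suc c) (suc s) ≈ ratio p c (suc s) + x (suc c) * ratio p (suc c) s
    ratio-sucʳ p c s with p ℕ.≤? c
    ... | yes p≤c = begin
      ratio p (suc c) (suc s)
        ≈⟨ ratio-h (suc s) (ℕ.m≤n⇒m≤1+n p≤c) ⟩
      h R (suc s) (vars R x p (suc c))
        ≡⟨ ≡.cong (h R (suc s)) (vars-∷ʳ p≤c) ⟩
      h R (suc s) (vars R x p c ++ [ y ])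
        ≈⟨ h-∷ʳ (vars R x p c) y s ⟩
      h R (suc s) (vars R x p c) + y * h R s (vars R x p c ++ [ y ])
        ≡⟨ ≡.cong (λ z → h R (suc s) (vars R x p c) + y * h R s z) (vars-∷ʳ p≤c) ⟨
      h R (suc s) (vars R x p c) + y * h R s (vars R x p (suc c))
        ≈⟨ +-cong (ratio-h (suc s) p≤c) (*-cong refl (ratio-h s (ℕ.m≤n⇒m≤1+n p≤c))) ⟨
      ratio p c (suc s) + y * ratio p (suc c) s ∎
      where y = x (suc c)
    ... | no p≰c = begin
      ratio p (suc c) (suc s)
        ≈⟨ ratio-e (suc s) c<p ⟩
      - (-1^ s · e R (suc s) V)
        ≈⟨ solve 3 (λ y a b → :- b := :- (y :* a :+ b) :+ y :* a) refl y (-1^ s · e R s V) (-1^ s · e R (suc s) V) ⟩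
      - (y * -1^ s · e R s V + -1^ s · e R (suc s) V) + y * -1^ s · e R s V
        ≈⟨ +-cong (-‿cong (trans (-1^-+ s _ _) (+-cong (-1^-*ʳ s y _) refl))) refl ⟨
      -1^ suc s · e R (suc s) (y ∷ V) + y * -1^ s · e R s V
        ≡⟨ ≡.cong (λ z → -1^ suc s · e R (suc s) z + y * -1^ s · e R s V) (vars-∷ c<p) ⟨
      -1^ suc s · e R (suc s) (vars R x c p) + y * -1^ s · e R s V
        ≈⟨ +-cong (ratio-e (suc s) (ℕ.<⇒≤ c<p)) (*-cong refl (ratio-e s c<p)) ⟨
      ratio p c (suc s) + y * ratio p (suc c) s ∎
      where
      c<p = ℕ.≰⇒> p≰c
      V = vars R x (suc c) p
      y = x (suc c)

    ratio-sucˡ : ∀ c p i → ratio (suc c) p (suc i) ≈ ratio c p (suc i) - x (suc c) * ratio c p i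
    ratio-sucˡ c p i with p ℕ.≤? c
    ... | yes p≤c = begin
      ratio (suc c) p (suc i)
        ≈⟨ ratio-e (suc i) (ℕ.m≤n⇒m≤1+n p≤c) ⟩
      -1^ suc i · e R (suc i) (vars R x p (suc c))
        ≡⟨ ≡.cong (λ z → -1^ suc i · e R (suc i) z) (vars-∷ʳ p≤c) ⟩
      -1^ suc i · e R (suc i) (W ++ [ y ])
        ≈⟨ -1^-cong (suc i) (e-∷ʳ W y i) ⟩
      - (-1^ i · (e R (suc i) W + y * e R i W))
        ≈⟨ -‿cong (trans (-1^-+ i _ _) (+-cong refl (-1^-*ʳ i y _))) ⟩
      - (-1^ i · e R (suc i) W + y * -1^ i · e R i W)
        ≈⟨ solve 3 (λ a y b → :- (a :+ y :* b) := :- a :- y :* b) refl _ y _ ⟩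
      -1^ suc i · e R (suc i) W - y * -1^ i · e R i W
        ≈⟨ +-cong (ratio-e (suc i) p≤c) (-‿cong (*-cong refl (ratio-e i p≤c))) ⟨
      ratio c p (suc i) - y * ratio c p i ∎
      where
      W = vars R x p c
      y = x (suc c)
    ... | no p≰c = begin
      ratio (suc c) p (suc i)
        ≈⟨ ratio-h (suc i) c<p ⟩
      h R (suc i) V
        ≈⟨ solve 2 (λ a b → b := (a :+ b) :- a) refl (y * h R i (y ∷ V)) (h R (suc i) V) ⟩
      h R (suc i) (y ∷ V) - y * h R i (y ∷ V)
        ≡⟨ ≡.cong (λ z → h R (suc i) z - y * h R i z) (vars-∷ c<p) ⟨
      h R (suc i) (vars R x c p) - y * h R i (vars R x c p)
        ≈⟨ +-cong (ratio-h (suc i) (ℕ.<⇒≤ c<p)) (-‿cong (*-cong refl (ratio-h i (ℕ.<⇒≤ c<p)))) ⟨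
      ratio c p (suc i) - y * ratio c p i ∎
      where
      c<p = ℕ.≰⇒> p≰c
      V = vars R x (suc c) p
      y = x (suc c)

    ratio-vanishes : ∀ {p q} t → q ℕ.≤ p → p ℕ.≤ q ℕ.+ t → ratio p q (suc t) ≈ 0#
    ratio-vanishes {p} {q} t q≤p p≤q+t = begin
      ratio p q (suc t)                         ≈⟨ ratio-e (suc t) q≤p ⟩
      -1^ suc t · e R (suc t) (vars R x q p)    ≈⟨ -1^-cong (suc t) (e-vanishes (suc t) (vars R x q p) short) ⟩
      -1^ suc t · 0#                            ≈⟨ -1^-zero (suc t) ⟩
      0#                                        ∎
      where
      short : length (vars R x q p) ℕ.< suc t
      short = s≤s (≡.subst (ℕ._≤ t) (≡.sym (length-vars q p))
                           (≡.subst (p ∸ q ℕ.≤_) (ℕ.m+n∸m≡n q t) (ℕ.∸-monoˡ-≤ q p≤q+t)))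

    h≈ratio : ∀ {p q} t → p ℕ.≤ q ℕ.+ t → h R (suc t) (vars R x p q) ≈ ratio p q (suc t)
    h≈ratio {p} {q} t p≤q+t with p ℕ.≤? q
    ... | yes p≤q = sym (ratio-h (suc t) p≤q)
    ... | no p≰q = begin
      h R (suc t) (vars R x p q)   ≡⟨ ≡.cong (h R (suc t)) (vars-empty q≤p) ⟩
      0#                           ≈⟨ ratio-vanishes t q≤p p≤q+t ⟨
      ratio p q (suc t)            ∎
      where q≤p = ℕ.<⇒≤ (ℕ.≰⇒> p≰q)

    e≈ratio : ∀ {p q} i → p ℕ.≤ q ⊎ i ≡ 0 → e R i (vars R x p q) ≈ -1^ i · ratio q p i
    e≈ratio i (inj₁ p≤q) = trans (sym (-1^-involutive i _)) (-1^-cong i (sym (ratio-e i p≤q)))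
    e≈ratio {p} {q} .0 (inj₂ ≡.refl) = sym (ratio-0 q p)

    ⋆-identityʳ : ∀ d (F G : ℕ → Carrier) → (∀ i → G (suc i) ≈ 0#) → G 0 ≈ 1# → (F ⋆ G) d ≈ F d
    ⋆-identityʳ zero F G G₊≈0 G₀≈1 = trans (+-identityʳ _) (trans (*-cong refl G₀≈1) (*-identityʳ _))
    ⋆-identityʳ (suc d) F G G₊≈0 G₀≈1 =
      trans (+-cong (trans (*-cong refl (G₊≈0 d)) (zeroʳ _)) (⋆-identityʳ d (λ s → F (suc s)) G G₊≈0 G₀≈1))
            (+-identityˡ _)

    ratio-⋆-suc : ∀ p c q d → (ratio p (suc c) ⋆ ratio (suc c) q) d ≈ (ratio p c ⋆ ratio c q) d
    ratio-⋆-suc p c q zero = +-cong (*-cong (trans (ratio-0 p (suc c)) (sym (ratio-0 p c)))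
                                            (trans (ratio-0 (suc c) q) (sym (ratio-0 c q)))) refl
    ratio-⋆-suc p c q (suc d) = sym (trans
      (+-cong (*-cong (trans (ratio-0 p c) (sym (ratio-0 p (suc c)))) refl) refl)
      (⋆-cancel d (ratio p (suc c)) (ratio p c) (ratio (suc c) q) (ratio c q) (x (suc c))
                (ratio-sucʳ p c) (ratio-sucˡ c q) (trans (ratio-0 (suc c) q) (sym (ratio-0 c q)))))

    ratio-⋆-independent : ∀ p q d c → (ratio p c ⋆ ratio c q) d ≈ (ratio p 0 ⋆ ratio 0 q) d
    ratio-⋆-independent p q d zero = refl
    ratio-⋆-independent p q d (suc c) = trans (ratio-⋆-suc p c q d) (ratio-⋆-independent p q d c)

    ratio-⋆ : ∀ p c q d → (ratio p c ⋆ ratio c q) d ≈ ratio p q d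
    ratio-⋆ p c q d = begin
      (ratio p c ⋆ ratio c q) d   ≈⟨ ratio-⋆-independent p q d c ⟩
      (ratio p 0 ⋆ ratio 0 q) d   ≈⟨ ratio-⋆-independent p q d q ⟨
      (ratio p q ⋆ ratio q q) d   ≈⟨ ⋆-identityʳ d (ratio p q) (ratio q q) ratio-qq (ratio-0 q q) ⟩
      ratio p q d                 ∎
      where
      ratio-qq : ∀ i → ratio q q (suc i) ≈ 0#
      ratio-qq i = trans (ratio-h {q} (suc i) ℕ.≤-refl) (reflexive (≡.cong (h R (suc i)) (vars-empty {q} ℕ.≤-refl)))

    -- The left side together with the term 1 · ratio (Q 0) p (d+1) telescopes to
    -- (ratio P (Q 0) ⋆ ratio (Q 0) p) (d+1) = ratio P p (d+1), which vanishes since P - p ≤ d.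
    ratio-antidiagonal : ∀ P p (Q : ℕ → ℕ) d → p ℕ.≤ P → P ℕ.≤ p ℕ.+ d → StepsDown d Q →
      ∑[ t < suc d ] (ratio P (Q t) (suc t) * ratio (Q (suc t)) p (d ∸ t)) ≈ - ratio (Q 0) p (suc d)
    ratio-antidiagonal P p Q d p≤P P≤p+d steps = begin
      Y                                                  ≈⟨ solve 2 (λ a y → y := (a :+ y) :- a) refl A Y ⟩
      (A + Y) - A                                        ≈⟨ +-cong (+-cong (*-identityˡ A) refl) refl ⟨
      (1# * A + Y) - A                                   ≈⟨ +-cong (+-cong (*-cong (ratio-0 P (Q 0)) refl) refl) refl ⟨
      (ratio P (Q 0) 0 * A + Y) - A                      ≈⟨ +-cong telescoped refl ⟩
      (ratio P (Q 0) ⋆ ratio (Q 0) p) (suc d) - A        ≈⟨ +-cong (ratio-⋆ P (Q 0) p (suc d)) refl ⟩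
      ratio P p (suc d) - A                              ≈⟨ +-cong (ratio-vanishes d p≤P P≤p+d) refl ⟩
      0# - A                                             ≈⟨ +-identityˡ _ ⟩
      - A                                                ∎
      where
      A Y : Carrier
      A = ratio (Q 0) p (suc d)
      Y = ∑[ t < suc d ] (ratio P (Q t) (suc t) * ratio (Q (suc t)) p (d ∸ t))
      Q′ : ℕ → ℕ
      Q′ zero = Q 0
      Q′ (suc r) = Q r
      steps′ : StepsDown (suc d) Q′
      steps′ zero _ = inj₁ ≡.refl
      steps′ (suc r) (s≤s r<d) = steps r r<d
      telescoped : ratio P (Q 0) 0 * A + Y ≈ (ratio P (Q 0) ⋆ ratio (Q 0) p) (suc d)
      telescoped = ⋆-telescope x (suc d) (ratio P) (λ c → ratio c p) Q′ (ratio-sucʳ P) (λ c → ratio-sucˡ c p)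
                               (λ c → ratio-0 c p) steps′

  ∑-alternating-antidiagonal : ∀ d (X : ℕ → Carrier) → ∑[ t < suc d ] (-1^ t · -1^ (d ∸ t) · X t) ≈ -1^ d · ∑< (suc d) X
  ∑-alternating-antidiagonal zero X = refl
  ∑-alternating-antidiagonal (suc d) X = begin
    -1^ suc d · X 0 + ∑[ t < suc d ] (- (-1^ t · -1^ (d ∸ t) · X (suc t)))
      ≈⟨ +-cong refl (∑-neg (suc d) (λ t → -1^ t · -1^ (d ∸ t) · X (suc t))) ⟩
    -1^ suc d · X 0 + - ∑[ t < suc d ] (-1^ t · -1^ (d ∸ t) · X (suc t))
      ≈⟨ +-cong refl (-‿cong (∑-alternating-antidiagonal d (λ t → X (suc t)))) ⟩
    - (-1^ d · X 0) + - (-1^ d · ∑[ t < suc d ] X (suc t))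
      ≈⟨ solve 2 (λ a b → :- a :+ :- b := :- (a :+ b)) refl _ _ ⟩
    - (-1^ d · X 0 + -1^ d · ∑[ t < suc d ] X (suc t))
      ≈⟨ -‿cong (-1^-+ d _ _) ⟨
    -1^ suc d · ∑< (suc (suc d)) X ∎

module _ {n : ℕ} {f : ℕ → ℕ} (step : StepPartition n f) where

  open import Data.Nat as ℕ using (zero; _∸_)
  import Data.Nat.Properties as ℕ
  open import Data.Product using (_×_; _,_; proj₁; proj₂)
  open import Data.Sum using (_⊎_; inj₁; inj₂)
  import Relation.Binary.PropositionalEquality as ≡

  private
    step-bound : ∀ {i} t → 1 ≤ i → i ℕ.+ suc t ≤ n → (1 ≤ i ℕ.+ t) × (i ℕ.+ t ℕ.< n)
    step-bound {i} t 1≤i bound = ℕ.≤-trans 1≤i (ℕ.m≤m+n i t) , ≡.subst (_≤ n) (ℕ.+-suc i t) bound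

  stepPartition-antitone-+ : ∀ i t → 1 ≤ i → i ℕ.+ t ≤ n → f (i ℕ.+ t) ≤ f i
  stepPartition-antitone-+ i zero 1≤i _ = ℕ.≤-reflexive (≡.cong f (ℕ.+-identityʳ i))
  stepPartition-antitone-+ i (suc t) 1≤i bound = begin
    f (i ℕ.+ suc t)   ≡⟨ ≡.cong f (ℕ.+-suc i t) ⟩
    f (suc (i ℕ.+ t)) ≤⟨ proj₁ (step (i ℕ.+ t) (proj₁ b) (proj₂ b)) ⟩
    f (i ℕ.+ t)       ≤⟨ stepPartition-antitone-+ i t 1≤i (ℕ.<⇒≤ (proj₂ b)) ⟩
    f i               ∎
    where
    open ℕ.≤-Reasoning
    b = step-bound t 1≤i bound

  stepPartition-drift : ∀ i t → 1 ≤ i → i ℕ.+ t ≤ n → f i ≤ f (i ℕ.+ t) ℕ.+ t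
  stepPartition-drift i zero 1≤i _ = ℕ.≤-reflexive (≡.sym (≡.trans (ℕ.+-identityʳ _) (≡.cong f (ℕ.+-identityʳ i))))
  stepPartition-drift i (suc t) 1≤i bound = begin
    f i                            ≤⟨ stepPartition-drift i t 1≤i (ℕ.<⇒≤ (proj₂ b)) ⟩
    f (i ℕ.+ t) ℕ.+ t              ≤⟨ ℕ.+-monoˡ-≤ t (proj₂ (step (i ℕ.+ t) (proj₁ b) (proj₂ b))) ⟩
    suc (f (suc (i ℕ.+ t))) ℕ.+ t  ≡⟨ ℕ.+-suc (f (suc (i ℕ.+ t))) t ⟨
    f (suc (i ℕ.+ t)) ℕ.+ suc t    ≡⟨ ≡.cong (λ j → f j ℕ.+ suc t) (ℕ.+-suc i t) ⟨
    f (i ℕ.+ suc t) ℕ.+ suc t      ∎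
    where
    open ℕ.≤-Reasoning
    b = step-bound t 1≤i bound

  stepPartition-antitone : ∀ i j → 1 ≤ i → i ≤ j → j ≤ n → f j ≤ f i
  stepPartition-antitone i j 1≤i i≤j j≤n = ≡.subst (λ k → f k ≤ f i) (ℕ.m+[n∸m]≡n i≤j)
    (stepPartition-antitone-+ i (j ∸ i) 1≤i (≡.subst (_≤ n) (≡.sym (ℕ.m+[n∸m]≡n i≤j)) j≤n))

  stepPartition-step : ∀ i → 1 ≤ i → i ℕ.< n → f i ≡ f (suc i) ⊎ f i ≡ suc (f (suc i))
  stepPartition-step i 1≤i i<n with ℕ.m≤n⇒m<n∨m≡n (proj₁ (step i 1≤i i<n))
  ... | inj₁ f₊<f = inj₂ (ℕ.≤-antisym (proj₂ (step i 1≤i i<n)) f₊<f)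
  ... | inj₂ f₊≡f = inj₁ (≡.sym f₊≡f)

module JacobiTrudi {c ℓ} (R : CommutativeRing c ℓ) (n : ℕ) (α β : ℕ → ℕ)
                   (α-step : StepPartition n α) (β-step : StepPartition n β)
                   (α≤β : ∀ i → 1 ≤ i → i ≤ n → α i ≤ β i) (x : ℕ → CommutativeRing.Carrier R) where

  open import Data.Nat as ℕ using (zero; z≤n; s≤s; _∸_; _<_)
  import Data.Nat.Properties as ℕ
  open import Data.Integer as ℤ using (+_; -[1+_])
  import Data.Integer.Properties as ℤ
  open import Data.Product using (_,_; ∃-syntax)
  open import Data.Sum using (_⊎_; inj₁; inj₂)
  import Relation.Binary.PropositionalEquality as ≡

  open CommutativeRing R hiding (zero)
  open Sums R
  open PowerSeries R
  open Ratio x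
  open Jacobi R using (InversePair)
  open import Relation.Binary.Reasoning.Setoid setoid

  H E : ℕ → ℕ → Carrier
  H a b = hℤ R (+ b ℤ.- + a) (vars R x (αExt n α (suc a)) (βExt β b))
  E a b = eℤ R (+ a ℤ.- + b) (vars R x (αExt n α a) (βExt β (suc b)))

  private
    difference-≥ : ∀ a b → a ≤ b → + b ℤ.- + a ≡ + (b ∸ a)
    difference-≥ a b a≤b = ≡.trans (ℤ.[+m]-[+n]≡m⊖n b a) (ℤ.⊖-≥ a≤b)

    difference-< : ∀ a b → b < a → ∃[ k ] + b ℤ.- + a ≡ -[1+ k ]
    difference-< (suc a) b (s≤s b≤a) = a ∸ b ,
      ≡.trans (ℤ.[+m]-[+n]≡m⊖n b (suc a)) (≡.trans (ℤ.⊖-< (s≤s b≤a)) (≡.cong (λ k → ℤ.- + k) (ℕ.+-∸-assoc 1 b≤a)))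

    hℤ-negative : ∀ {i} ys → ∃[ k ] i ≡ -[1+ k ] → hℤ R i ys ≈ 0#
    hℤ-negative ys (k , ≡.refl) = refl

    eℤ-negative : ∀ {i} ys → ∃[ k ] i ≡ -[1+ k ] → eℤ R i ys ≈ 0#
    eℤ-negative ys (k , ≡.refl) = refl

    αExt-≤ : ∀ j → j ≤ n → αExt n α j ≡ α j
    αExt-≤ j j≤n = ≡.cong α (ℕ.m≤n⇒m⊓n≡m j≤n)

    βExt-suc : ∀ j → βExt β (suc j) ≡ β (suc j)
    βExt-suc j = ≡.cong (λ k → β (suc k)) (ℕ.⊔-identityʳ j)

    1+k+t∸k : ∀ k t → suc k ℕ.+ t ∸ k ≡ suc t
    1+k+t∸k k t = ≡.trans (ℕ.+-∸-assoc 1 (ℕ.m≤m+n k t)) (≡.cong suc (ℕ.m+n∸m≡n k t))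

  H-ratio : ∀ k t → suc k ℕ.+ t ≤ n → H k (suc k ℕ.+ t) ≈ ratio (α (suc k)) (β (suc k ℕ.+ t)) (suc t)
  H-ratio k t bound = begin
    H k (suc k ℕ.+ t)
      ≡⟨ ≡.cong₂ (hℤ R) (≡.trans (difference-≥ k (suc k ℕ.+ t) (ℕ.≤-trans (ℕ.n≤1+n k) (ℕ.m≤m+n (suc k) t)))
                                 (≡.cong +_ (1+k+t∸k k t)))
                        (≡.cong₂ (vars R x) (αExt-≤ (suc k) 1+k≤n) (βExt-suc (k ℕ.+ t))) ⟩
    h R (suc t) (vars R x (α (suc k)) (β (suc k ℕ.+ t)))
      ≈⟨ h≈ratio t (ℕ.≤-trans (α≤β (suc k) (s≤s z≤n) 1+k≤n)
                              (stepPartition-drift β-step (suc k) t (s≤s z≤n) bound)) ⟩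
    ratio (α (suc k)) (β (suc k ℕ.+ t)) (suc t) ∎
    where
    1+k≤n : suc k ≤ n
    1+k≤n = ℕ.m+n≤o⇒m≤o (suc k) bound

  E-ratio : ∀ k d t → suc k ℕ.+ d ≤ n → t ≤ d →
            E (suc k ℕ.+ d) (suc k ℕ.+ t) ≈ -1^ (d ∸ t) · ratio (β (suc k ℕ.+ suc t)) (α (suc k ℕ.+ d)) (d ∸ t)
  E-ratio k d t bound t≤d = begin
    E (suc k ℕ.+ d) (suc k ℕ.+ t)
      ≡⟨ ≡.cong₂ (eℤ R) (≡.trans (difference-≥ (suc k ℕ.+ t) (suc k ℕ.+ d) (ℕ.+-monoʳ-≤ (suc k) t≤d))
                                 (≡.cong +_ (ℕ.[m+n]∸[m+o]≡n∸o (suc k) d t)))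
                        (≡.cong₂ (vars R x) (αExt-≤ (suc k ℕ.+ d) bound)
                                            (≡.trans (βExt-suc (suc k ℕ.+ t)) (≡.cong β (≡.sym (ℕ.+-suc (suc k) t))))) ⟩
    e R (d ∸ t) (vars R x (α (suc k ℕ.+ d)) (β (suc k ℕ.+ suc t)))
      ≈⟨ e≈ratio (d ∸ t) below-or-empty ⟩
    -1^ (d ∸ t) · ratio (β (suc k ℕ.+ suc t)) (α (suc k ℕ.+ d)) (d ∸ t) ∎
    where
    below-or-empty : α (suc k ℕ.+ d) ≤ β (suc k ℕ.+ suc t) ⊎ d ∸ t ≡ 0
    below-or-empty with ℕ.m≤n⇒m<n∨m≡n t≤d
    ... | inj₂ t≡d = inj₂ (≡.trans (≡.cong (d ∸_) t≡d) (ℕ.n∸n≡0 d))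
    ... | inj₁ t<d = inj₁ (ℕ.≤-trans (α≤β (suc k ℕ.+ d) (s≤s z≤n) bound)
                                     (stepPartition-antitone β-step (suc k ℕ.+ suc t) (suc k ℕ.+ d) (s≤s z≤n)
                                                              (ℕ.+-monoʳ-≤ (suc k) t<d) bound))

  -- Row k of H against row a = k + 1 + d of E: only the columns k + 1 + t with t ≤ d survive, and there the
  -- entries are coefficients of the series ratio, so the sum is the antidiagonal sum of ratio-antidiagonal.
  E-recurrence : ∀ k d → suc k ℕ.+ d ≤ n →
                 E (suc k ℕ.+ d) k ≈ ∑[ t < n ∸ k ] (-1^ t · (H k (suc k ℕ.+ t) * E (suc k ℕ.+ d) (suc k ℕ.+ t)))
  E-recurrence k d bound = sym (begin
    ∑< (n ∸ k) term
      ≡⟨ ≡.cong (λ m → ∑< m term) n∸k≡1+d+w ⟩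
    ∑< (suc d ℕ.+ w) term
      ≈⟨ ∑-+ (suc d) w term ⟩
    ∑< (suc d) term + ∑[ t < w ] term (suc d ℕ.+ t)
      ≈⟨ +-cong refl (∑-zero w tail-vanishes) ⟩
    ∑< (suc d) term + 0#
      ≈⟨ +-identityʳ _ ⟩
    ∑< (suc d) term
      ≈⟨ ∑-cong (suc d) (λ t t≤d → term-ratio t (ℕ.≤-pred t≤d)) ⟩
    ∑[ t < suc d ] (-1^ t · -1^ (d ∸ t) · (ratio P (Q t) (suc t) * ratio (Q (suc t)) p (d ∸ t)))
      ≈⟨ ∑-alternating-antidiagonal d (λ t → ratio P (Q t) (suc t) * ratio (Q (suc t)) p (d ∸ t)) ⟩
    -1^ d · ∑[ t < suc d ] (ratio P (Q t) (suc t) * ratio (Q (suc t)) p (d ∸ t))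
      ≈⟨ -1^-cong d (ratio-antidiagonal P p Q d p≤P P≤p+d steps) ⟩
    -1^ d · - ratio (Q 0) p (suc d)
      ≈⟨ -1^-neg d _ ⟩
    -1^ suc d · ratio (Q 0) p (suc d)
      ≈⟨ e≈ratio (suc d) (inj₁ p≤Q₀) ⟨
    e R (suc d) (vars R x p (Q 0))
      ≡⟨ ≡.cong₂ (eℤ R) (≡.trans (difference-≥ k a (ℕ.≤-trans (ℕ.n≤1+n k) (ℕ.m≤m+n (suc k) d)))
                                 (≡.cong +_ (1+k+t∸k k d)))
                        (≡.cong₂ (vars R x) (αExt-≤ a bound)
                                            (≡.trans (βExt-suc k) (≡.cong β (≡.sym (ℕ.+-identityʳ (suc k)))))) ⟨
    E a k ∎)
    where
    a w P p : ℕ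
    a = suc k ℕ.+ d
    w = n ∸ a
    P = α (suc k)
    p = α a
    Q : ℕ → ℕ
    Q t = β (suc k ℕ.+ t)
    term : ℕ → Carrier
    term t = -1^ t · (H k (suc k ℕ.+ t) * E a (suc k ℕ.+ t))
    n∸k≡1+d+w : n ∸ k ≡ suc d ℕ.+ w
    n∸k≡1+d+w = ≡.trans (≡.cong (_∸ k) (≡.trans (≡.sym (ℕ.m+[n∸m]≡n bound)) (ℕ.+-assoc (suc k) d w)))
                        (≡.trans (≡.cong (_∸ k) (≡.sym (ℕ.+-suc k (d ℕ.+ w)))) (ℕ.m+n∸m≡n k (suc d ℕ.+ w)))
    tail-vanishes : ∀ t → term (suc d ℕ.+ t) ≈ 0#
    tail-vanishes t = trans (-1^-cong (suc d ℕ.+ t) (trans (*-cong refl (eℤ-negative _ (difference-< _ a a<column)))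
                                                           (zeroʳ _)))
                            (-1^-zero (suc d ℕ.+ t))
      where
      a<column : a < suc k ℕ.+ (suc d ℕ.+ t)
      a<column = ≡.subst (_≤ suc k ℕ.+ (suc d ℕ.+ t)) (ℕ.+-suc (suc k) d) (ℕ.+-monoʳ-≤ (suc k) (ℕ.m≤m+n (suc d) t))
    term-ratio : ∀ t → t ≤ d → term t ≈ -1^ t · -1^ (d ∸ t) · (ratio P (Q t) (suc t) * ratio (Q (suc t)) p (d ∸ t))
    term-ratio t t≤d = -1^-cong t (trans
      (*-cong (H-ratio k t (ℕ.≤-trans (ℕ.+-monoʳ-≤ (suc k) t≤d) bound)) (E-ratio k d t bound t≤d))
      (sym (-1^-*ʳ (d ∸ t) _ _)))
    p≤P : p ≤ P
    p≤P = stepPartition-antitone-+ α-step (suc k) d (s≤s z≤n) bound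
    P≤p+d : P ≤ p ℕ.+ d
    P≤p+d = stepPartition-drift α-step (suc k) d (s≤s z≤n) bound
    p≤Q₀ : p ≤ Q 0
    p≤Q₀ = ℕ.≤-trans (α≤β a (s≤s z≤n) bound)
                     (stepPartition-antitone β-step (suc k ℕ.+ 0) a (s≤s z≤n) (ℕ.+-monoʳ-≤ (suc k) z≤n) bound)
    steps : StepsDown d Q
    steps r r<d with stepPartition-step β-step (suc k ℕ.+ r) (s≤s z≤n)
                       (≡.subst (_≤ n) (ℕ.+-suc (suc k) r) (ℕ.≤-trans (ℕ.+-monoʳ-≤ (suc k) r<d) bound))
    ... | inj₁ same = inj₁ (≡.trans same (≡.cong β (≡.sym (ℕ.+-suc (suc k) r))))
    ... | inj₂ drop = inj₂ (≡.trans drop (≡.cong (λ j → suc (β j)) (≡.sym (ℕ.+-suc (suc k) r))))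

  inversePair : InversePair (suc n) H E
  inversePair = record
    { H-upperTriangular = λ a b b<a → hℤ-negative _ (difference-< a b b<a)
    ; H-diagonal        = λ a → reflexive (≡.cong (λ i → hℤ R i (vars R x (αExt n α (suc a)) (βExt β a))) (diagonal a))
    ; E-lowerTriangular = λ a b a<b → eℤ-negative _ (difference-< b a a<b)
    ; E-diagonal        = λ a → reflexive (≡.cong (λ i → eℤ R i (vars R x (αExt n α a) (βExt β (suc a)))) (diagonal a))
    ; E-recurrence      = λ k a k<a a<1+n →
        ≡.subst (λ a → E a k ≈ ∑[ t < n ∸ k ] (-1^ t · (H k (suc k ℕ.+ t) * E a (suc k ℕ.+ t))))
                (ℕ.m+[n∸m]≡n k<a)
                (E-recurrence k (a ∸ suc k) (≡.subst (_≤ n) (≡.sym (ℕ.m+[n∸m]≡n k<a)) (ℕ.≤-pred a<1+n)))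
    }
    where
    diagonal : ∀ a → + a ℤ.- + a ≡ + 0
    diagonal a = ≡.trans (difference-≥ a a ℕ.≤-refl) (≡.cong +_ (ℕ.n∸n≡0 a))

theorem1p3 : ∀ {c ℓ : Level} (R : CommutativeRing c ℓ) (n : ℕ)
    (A B : Subset (suc n)) → ∣ A ∣ ≡ ∣ B ∣ →
    (α β : ℕ → ℕ) → StepPartition n α → StepPartition n β →
    (∀ i → 1 ≤ i → i ≤ n → α i ≤ β i) →
    (x : ℕ → CommutativeRing.Carrier R) →
    CommutativeRing._≈_ R
    (hDet R n α β x (elems A) (elems B))
    (eDet R n α β x (elems (∁ A)) (elems (∁ B)))
theorem1p3 R n A B |A|≡|B| α β α-step β-step α≤β x =
  Jacobi.complementaryMinors R (suc n) A B |A|≡|B| (JacobiTrudi.inversePair R n α β α-step β-step α≤β x)
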